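{- Let $F$ be a totally imaginary number field, $n,n'\ge1$, $N=n+n'$. Let $\mu$, $\mu'$ be strongly-pure weights for $\mathrm{GL}_n$, $\mathrm{GL}_{n'}$ over $F$ (indexed by $\mathrm{Hom}(F,\mathbb{C})$) and $\sigma,\sigma'$ cuspidal automorphic representations of $\mathrm{GL}_n(\mathbb{A}_F)$, $\mathrm{GL}_{n'}(\mathbb{A}_F)$ contributing to cuspidal cohomology with respect to $\mu$, $\mu'$. The following are equivalent: (1) the points $s=-N/2$ and $s=1-N/2$ are both critical for $L(s,\sigma\times\sigma'^{\mathsf v})$; (2) $-\frac N2+1-\frac{\ell(\mu,\mu')}2\le a(\mu,\mu')\le -\frac N2-1+\frac{\ell(\mu,\mu')}{2}$; (3) there exists $w=(w^\eta)_{\eta\in\mathrm{Hom}(F,\mathbb{C})}$ with each $w^\eta\in W^{P_0}$ such that for every $\eta$ the tuple $(w^\eta)^{ -1}\cdot(b^\eta_1,\dots,b^\eta_n,b'^\eta_1,\dots,b'^\eta_{n'})$ is non-increasing, and $l(w^\eta)+l(w^{\bar\eta})=nn'$ for every $\eta$.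
   Context: Weights: $\mu^\eta=(b^\eta_1\ge\cdots\ge b^\eta_n)$, $\mu'^\eta=(b'^\eta_1\ge\cdots\ge b'^\eta_{n'})$ integers; strongly-pure: there is $\mathsf w$ with $b^{\varsigma^{ -1}\eta}_j+b^{\varsigma^{ -1}\bar\eta}_{n-j+1}=\mathsf w$ for all $\eta$, $j$, $\varsigma\in\mathrm{Aut}(\mathbb{C})$ (similarly $\mathsf w'$ for $\mu'$). Abelian width $a(\mu,\mu')=(\mathsf w-\mathsf w')/2$. For each archimedean place $v$ fix $\eta_v$ in its conjugate pair; $\alpha^v_i=-b^{\eta_v}_{n-i+1}+\frac{n-2i+1}2$, $\beta^v_i=-b^{\bar\eta_v}_i-\frac{n-2i+1}2$, similarly $\alpha'^v_j,\beta'^v_j$; cuspidal width $\ell(\mu,\mu')=\min_{v,i,j}|\alpha^v_i-\alpha'^v_j-\beta^v_i+\beta'^v_j|$. Critical: $m\in\frac N2+\mathbb{Z}$ with both $\prod_{v,i,j}L(s,z^{\alpha^v_i-\alpha'^v_j}\bar z^{\beta^v_i-\beta'^v_j})$ and $\prod_{v,i,j}L(1-s,z^{ -\alpha^v_i+\alpha'^v_j}\bar z^{ -\beta^v_i+\beta'^v_j})$ finite at $s=m$, where $L(s,z^a\bar z^b)=2(2\pi)^{ -(s+\frac{a+b}2+\frac{|a-b|}2)}\Gamma(s+\frac{a+b}2+\frac{|a-b|}2)$. $W^{P_0}$ is the set of $w\in S_N$ with $w^{ -1}(1)<\cdots<w^{ -1}(n)$ and $w^{ -1}(n+1)<\cdots<w^{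 -1}(N)$ (Kostant representatives for the $(n,n')$ parabolic); $l$ is the length (number of inversions). $S_N$ acts on $N$-tuples by $\sigma(t_1,\dots,t_N)=(t_{\sigma^{ -1}(1)},\dots,t_{\sigma^{ -1}(N)})$ and the twisted action is $\sigma\cdot t=\sigma(t+\rho)-\rho$ with $\rho=(\frac{N-1}2,\frac{N-3}2,\dots,-\frac{N-1}2)$. -}

module Defs where

open import Data.Nat as ℕ using (ℕ; zero; suc)
open import Data.Integer as ℤ using (ℤ; +_)
open import Data.Rational as ℚ using (ℚ; _/_; ½; ∣_∣)
open import Data.Rational.Properties as ℚP using ()
open import Data.Fin as Fin using (Fin; toℕ; opposite; splitAt; _↑ˡ_; _↑ʳ_)
open import Data.Fin.Properties as FinP using ()
open import Data.Fin.Permutation using (Permutation′; _⟨$⟩ʳ_; _⟨$⟩ˡ_)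
open import Data.Bool using (Bool; true; false; not)
open import Data.Product using (_×_; _,_; ∃)
open import Data.Sum using (inj₁; inj₂)
open import Data.List using (List; []; _∷_; map; length; filter; cartesianProduct; concatMap; allFin)
import Data.List.Extrema
open import Relation.Binary.Bundles using (DecTotalOrder)
open import Relation.Binary.PropositionalEquality using (_≡_)
open import Relation.Nullary using (¬_)
open import Relation.Nullary.Decidable using (_×-dec_)

-- Embeddings of a totally imaginary number field F of degree 2r.
-- The archimedean places are v : Fin r; for each place we fixed
-- η_v = (v , true); its conjugate η̄_v is (v , false).

Emb : ℕ → Set
Emb r = Fin r × Bool

conj : ∀ {r} → Emb r → Emb r
conj (v , s) = (v , not s)

-- The action of Aut(ℂ) on Hom(F,ℂ), η ↦ ς⁻¹ ∘ η, abstracted: a type of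
-- automorphisms acting on the embeddings, containing the identity.
-- (The action also satisfies ς⁻¹ ∘ η̄ = act ς (conj η).)
record AutAction (r : ℕ) : Set₁ where
  field
    Aut   : Set
    act   : Aut → Emb r → Emb r
    idAut : Aut
    act-id : ∀ η → act idAut η ≡ η

-- Strongly-pure weights for GL_n over F (1-based index j ↔ Fin n j-1;
-- n - j + 1 ↔ opposite j).

record StronglyPureWeight (r : ℕ) (A : AutAction r) (n : ℕ) : Set where
  open AutAction A
  field
    b        : Emb r → Fin n → ℤ
    dominant : ∀ η (i j : Fin n) → toℕ i ℕ.≤ toℕ j → b η j ℤ.≤ b η i
    𝗐        : ℤ
    pure     : ∀ (ς : Aut) η (j : Fin n) →
               b (act ς η) j ℤ.+ b (act ς (conj η)) (opposite j) ≡ 𝗐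
open StronglyPureWeight public

⟦_⟧ : ℤ → ℚ
⟦ z ⟧ = z / 1

⟦_⟧ℕ : ℕ → ℚ
⟦ k ⟧ℕ = ⟦ + k ⟧

abelianWidth : ∀ {r A n n'} → StronglyPureWeight r A n → StronglyPureWeight r A n' → ℚ
abelianWidth μ μ' = (⟦ 𝗐 μ ⟧ ℚ.- ⟦ 𝗐 μ' ⟧) ℚ.* ½

-- α^v_i = -b^{η_v}_{n-i+1} + (n-2i+1)/2, with i = toℕ i + 1 (so n-2i+1 = n - 1 - 2·toℕ i)
α : ∀ {r A n} → StronglyPureWeight r A n → Fin r → Fin n → ℚ
α {n = n} μ v i = ℚ.- ⟦ b μ (v , true) (opposite i) ⟧
              ℚ.+ (⟦ n ⟧ℕ ℚ.- ⟦ 1 ℕ.+ 2 ℕ.* toℕ i ⟧ℕ) ℚ.* ½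

β : ∀ {r A n} → StronglyPureWeight r A n → Fin r → Fin n → ℚ
β {n = n} μ v i = ℚ.- ⟦ b μ (v , false) i ⟧
              ℚ.- (⟦ n ⟧ℕ ℚ.- ⟦ 1 ℕ.+ 2 ℕ.* toℕ i ⟧ℕ) ℚ.* ½

open Data.List.Extrema (DecTotalOrder.totalOrder ℚP.≤-decTotalOrder) using (min)

-- minimum of a list (the lists used below are non-empty)
minList : List ℚ → ℚ
minList []       = ℚ.0ℚ
minList (x ∷ xs) = min x xs

triples : ∀ r n n' → List (Fin r × Fin n × Fin n')
triples r n n' = concatMap (λ v → concatMap (λ i → map (λ j → v , i , j) (allFin n')) (allFin n)) (allFin r)

cuspidalWidth : ∀ {r A n n'} → StronglyPureWeight r A n → StronglyPureWeight r A n' → ℚ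
cuspidalWidth {r} {A} {n} {n'} μ μ' =
  minList (map (λ { (v , i , j) → ∣ α μ v i ℚ.- α μ' v j ℚ.- β μ v i ℚ.+ β μ' v j ∣ })
               (triples r n n'))

-- Γ has a pole at x iff x ∈ {0, -1, -2, ...}
IsPole : ℚ → Set
IsPole x = ∃ λ (k : ℕ) → x ≡ ℚ.- ⟦ k ⟧ℕ

-- L(s, z^a z̄^b) = 2(2π)^{-(s + (a+b)/2 + |a-b|/2)} Γ(s + (a+b)/2 + |a-b|/2)
-- is finite at s iff the Gamma argument is not a pole.
LFiniteAt : ℚ → ℚ → ℚ → Set
LFiniteAt s a b' = ¬ IsPole (s ℚ.+ (a ℚ.+ b') ℚ.* ½ ℚ.+ ∣ a ℚ.- b' ∣ ℚ.* ½)

-- m is critical for L(s, σ × σ'^∨): m ∈ N/2 + ℤ and both finite products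
-- (of everywhere non-vanishing factors) are finite at s = m, i.e. every factor is.
Critical : ∀ {r A n n'} → StronglyPureWeight r A n → StronglyPureWeight r A n' → ℚ → Set
Critical {r} {A} {n} {n'} μ μ' m =
  (∃ λ (k : ℤ) → m ≡ ⟦ + (n ℕ.+ n') ⟧ ℚ.* ½ ℚ.+ ⟦ k ⟧)
  × (∀ (v : Fin r) (i : Fin n) (j : Fin n') →
       LFiniteAt m (α μ v i ℚ.- α μ' v j) (β μ v i ℚ.- β μ' v j))
  × (∀ (v : Fin r) (i : Fin n) (j : Fin n') →
       LFiniteAt (ℚ.1ℚ ℚ.- m) (ℚ.- (α μ v i ℚ.- α μ' v j)) (ℚ.- (β μ v i ℚ.- β μ' v j)))

InWP0 : ∀ n n' → Permutation′ (n ℕ.+ n') → Set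
InWP0 n n' w =
  (∀ (i j : Fin n) → toℕ i ℕ.< toℕ j → toℕ (w ⟨$⟩ˡ (i ↑ˡ n')) ℕ.< toℕ (w ⟨$⟩ˡ (j ↑ˡ n')))
  × (∀ (i j : Fin n') → toℕ i ℕ.< toℕ j → toℕ (w ⟨$⟩ˡ (n ↑ʳ i)) ℕ.< toℕ (w ⟨$⟩ˡ (n ↑ʳ j)))

len : ∀ {N} → Permutation′ N → ℕ
len {N} w = length (filter (λ { (i , j) → (i Fin.<? j) ×-dec ((w ⟨$⟩ʳ j) Fin.<? (w ⟨$⟩ʳ i)) })
                           (cartesianProduct (allFin N) (allFin N)))

-- ρ = ((N-1)/2, (N-3)/2, ..., -(N-1)/2); ρ_k (0-based k) = (N-1)/2 - k
ρ : ∀ N → Fin N → ℚ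
ρ N k = (+ N / 1 ℚ.- ℚ.1ℚ) ℚ.* ½ ℚ.- (+ toℕ k / 1)

permAct : ∀ {N} → Permutation′ N → (Fin N → ℚ) → (Fin N → ℚ)
permAct σ t k = t (σ ⟨$⟩ˡ k)

dotAct : ∀ {N} → Permutation′ N → (Fin N → ℚ) → (Fin N → ℚ)
dotAct {N} σ t k = permAct σ (λ k' → t k' ℚ.+ ρ N k') k ℚ.- ρ N k

inv : ∀ {N} → Permutation′ N → Permutation′ N
inv = Data.Fin.Permutation.flip

NonIncreasing : ∀ {N} → (Fin N → ℚ) → Set
NonIncreasing t = ∀ i j → toℕ i ℕ.≤ toℕ j → t j ℚ.≤ t i

concatWeights : ∀ {r A n n'} → StronglyPureWeight r A n → StronglyPureWeight r A n' →
                Emb r → Fin (n ℕ.+ n') → ℚ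
concatWeights {n = n} μ μ' η k with splitAt n k
... | inj₁ i = b μ η i / 1
... | inj₂ j = b μ' η j / 1

module Submission where

-- Fix a place v and indices i, j; let u be the gap (b'^η̄_j - n - j) - (b^η̄_i - i) between the
-- ρ-shifted weights at η̄ = η̄_v, and put c = 2 a(μ,μ') + N.  All three conditions are equivalent to:
-- for all v, i, j, the integers u and u + c are nonzero and have the same sign.
--
-- (1) By purity, α - α' + β - β' = 𝗐' - 𝗐 and α - α' - β + β' = -(2u + c).  Hence the four Gamma
--     arguments at s = -N/2 and s = 1 - N/2 are the integers p, q + 1, p + 1, q, where
--     p = u ⊔ -(u + c) and q = (u + c) ⊔ -u are the halves of ∣2u + c∣ ∓ c.  Both p and q are
--     positive exactly in the same-sign case.
-- (2) ℓ(μ,μ') is the minimum of ∣2u + c∣, and the two inequalities say c + 2 ≤ ∣2u + c∣ and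
--     2 - c ≤ ∣2u + c∣ everywhere, i.e. 0 < p and 0 < q.
-- (3) The dotted weight (w^η)⁻¹ · (b^η, b'^η) is non-increasing iff w^η sorts the ρ-shifted
--     concatenated weight; such a w^η lies in W^P₀ and its length counts the positive gaps at η.
--     By purity the gaps at η_v are -(u + c) at reversed indices, so l(w^η_v) + l(w^η̄_v) is the sum
--     over (i, j) of [u + c < 0] + [0 < u].  Every term is ≤ 1 if c ≥ 0 and ≥ 1 if c < 0, so the sum
--     is nn' iff every term is 1, i.e. iff u and u + c have the same sign.

open import Level using (0ℓ)
open import Data.Nat as ℕ using (ℕ; zero; suc)
import Data.Nat.Properties as ℕP
import Data.Nat.Coprimality as Coprimality
open import Data.Integer as ℤ using (ℤ; +_; -[1+_]; 0ℤ; _⊔_; _+_; _-_; -_; _<_; _≤_; _<?_; _≤?_)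
import Data.Integer.Properties as ℤP
open import Data.Integer.Tactic.RingSolver using (solve-∀)
open import Data.Rational as ℚ using (ℚ; ½; 1ℚ; 0ℚ)
import Data.Rational.Properties as ℚP
import Data.Rational.Literals as ℚL
open import Data.Fin as Fin using (Fin; toℕ; fromℕ<; opposite; splitAt; _↑ˡ_; _↑ʳ_)
import Data.Fin.Properties as FinP
open import Data.Fin.Permutation as Perm using (Permutation′; _⟨$⟩ʳ_; _⟨$⟩ˡ_; permutation; inverseʳ)
open import Data.Vec.Functional using (_++_)
open import Data.Vec.Functional.Properties using (lookup-++ˡ; lookup-++ʳ)
open import Data.Bool using (true; false)
open import Data.Maybe using (Maybe; just; nothing)
open import Data.Product using (_×_; _,_; ∃; proj₁; proj₂)
open import Data.Sum using (_⊎_; inj₁; inj₂)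
open import Data.List as List using (List; []; _∷_; map; length; filter; cartesianProduct; tabulate)
import Data.List.Properties as ListP
import Data.List.Extrema
open import Data.List.Relation.Unary.All as All using (All; []; _∷_)
import Data.List.Relation.Unary.All.Properties as AllP
open import Function using (_∘_; _∘′_)
open import Function.Definitions using (Injective)
open import Function.Bundles using (_⇔_; mk⇔; Equivalence)
import Function.Properties.Equivalence as ⇔
open import Relation.Nullary using (¬_; Dec; yes; no; contradiction)
open import Relation.Nullary.Decidable using (_×-dec_)
open import Relation.Unary using (Decidable)
open import Relation.Binary using (tri<; tri≈; tri>)
open import Relation.Binary.Bundles using (DecTotalOrder)
open import Relation.Binary.PropositionalEquality
import Relation.Binary.Reasoning.Setoid as SetoidReasoning
import Tactic.RingSolver as RingSolver
import Tactic.RingSolver.Core.AlmostCommutativeRing as ACR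
open import Algebra.Properties.CommutativeMonoid.Sum ℕP.+-0-commutativeMonoid
  using (sum; sum-syntax; sum-cong-≗; sum-permute; ∑-comm; ∑-distrib-+)
open import Defs

0<-i⇒i<0 : ∀ {i} → 0ℤ < - i → i < 0ℤ
0<-i⇒i<0 = ℤP.neg-cancel-< {0ℤ}

+∣i∣≡-i : ∀ {i} → i ≤ 0ℤ → + ℤ.∣ i ∣ ≡ - i
+∣i∣≡-i {i} i≤0 = trans (cong +_ (sym (ℤP.∣-i∣≡∣i∣ i))) (ℤP.0≤i⇒+∣i∣≡i (ℤP.neg-mono-≤ i≤0))

+-cancelʳ-< : ∀ {i j} k → i + k < j + k → i < j
+-cancelʳ-< {i} {j} k lt = subst₂ _<_ (cancel i k) (cancel j k) (ℤP.+-monoˡ-< (- k) lt)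
  where
  cancel : ∀ a k → a + k + - k ≡ a
  cancel = solve-∀

<⇔0<- : ∀ i j → i < j ⇔ 0ℤ < j - i
<⇔0<- i j = mk⇔
  (λ i<j → subst (_< j - i) (ℤP.+-inverseʳ i) (ℤP.+-monoˡ-< (- i) i<j))
  (λ 0<j-i → subst₂ _<_ (ℤP.+-identityˡ i) (restore i j) (ℤP.+-monoˡ-< i 0<j-i))
  where
  restore : ∀ i j → j - i + i ≡ j
  restore = solve-∀

k+2≤x+x+k⇔0<x : ∀ k x → k + + 2 ≤ x + x + k ⇔ 0ℤ < x
k+2≤x+x+k⇔0<x k x = mk⇔
  (λ le → ℤP.≰⇒> λ x≤0 → ℤP.<⇒≱ (ℤ.+<+ (ℕ.s≤s ℕ.z≤n)) (ℤP.≤-trans (cancel le) (ℤP.+-mono-≤ x≤0 x≤0)))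
  (λ 0<x → let 1≤x = ℤP.i<j⇒suc[i]≤j 0<x in
     subst₂ _≤_ (ℤP.+-comm (+ 2) k) refl (ℤP.+-monoˡ-≤ k (ℤP.+-mono-≤ 1≤x 1≤x)))
  where
  cancel : k + + 2 ≤ x + x + k → + 2 ≤ x + x
  cancel le = subst₂ _≤_ (drop-k (+ 2) k) (drop-k (x + x) k) (ℤP.+-monoˡ-≤ (- k) (subst (_≤ x + x + k) (ℤP.+-comm k (+ 2)) le))
    where
    drop-k : ∀ a k → a + k + - k ≡ a
    drop-k = solve-∀

SameSign : ℤ → ℤ → Set
SameSign x y = (0ℤ < x × 0ℤ < y) ⊎ (x < 0ℤ × y < 0ℤ)

sameSign⇒≢0 : ∀ {x y} → SameSign x y → x ≢ 0ℤ × y ≢ 0ℤ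
sameSign⇒≢0 (inj₁ (0<x , 0<y)) = (λ x≡0 → ℤP.<-irrefl (sym x≡0) 0<x) , (λ y≡0 → ℤP.<-irrefl (sym y≡0) 0<y)
sameSign⇒≢0 (inj₂ (x<0 , y<0)) = (λ x≡0 → ℤP.<-irrefl x≡0 x<0) , (λ y≡0 → ℤP.<-irrefl y≡0 y<0)

0<⊔⇒0<ʳ : ∀ {i j} → 0ℤ < i ⊔ j → i ≤ 0ℤ → 0ℤ < j
0<⊔⇒0<ʳ {i} {j} 0<i⊔j i≤0 with 0ℤ <? j
... | yes 0<j = 0<j
... | no  0≮j = contradiction 0<i⊔j (ℤP.≤⇒≯ (ℤP.⊔-lub i≤0 (ℤP.≮⇒≥ 0≮j)))

0<⊔⇒0<ˡ : ∀ {i j} → 0ℤ < i ⊔ j → j ≤ 0ℤ → 0ℤ < i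
0<⊔⇒0<ˡ {i} {j} 0<i⊔j = 0<⊔⇒0<ʳ (subst (0ℤ <_) (ℤP.⊔-comm i j) 0<i⊔j)

∣+∣≡⊔-double : ∀ x y → + ℤ.∣ x + y ∣ ≡ (x ⊔ - y) + (x ⊔ - y) + (y - x)
∣+∣≡⊔-double x y with 0ℤ ≤? x + y
... | yes 0≤x+y = begin
  + ℤ.∣ x + y ∣                    ≡⟨ ℤP.0≤i⇒+∣i∣≡i 0≤x+y ⟩
  x + y                            ≡⟨ ring x y ⟩
  x + x + (y - x)                  ≡⟨ cong (λ m → m + m + (y - x)) (ℤP.i≥j⇒i⊔j≡i -y≤x) ⟨
  (x ⊔ - y) + (x ⊔ - y) + (y - x)  ∎
  where
  open ≡-Reasoning
  -y≤x : - y ≤ x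
  -y≤x = ℤP.0≤i-j⇒j≤i (subst (λ t → 0ℤ ≤ x + t) (sym (ℤP.neg-involutive y)) 0≤x+y)
  ring : ∀ x y → x + y ≡ x + x + (y - x)
  ring = solve-∀
... | no  0≰x+y = begin
  + ℤ.∣ x + y ∣                    ≡⟨ +∣i∣≡-i x+y≤0 ⟩
  - (x + y)                        ≡⟨ ring x y ⟩
  - y + - y + (y - x)              ≡⟨ cong (λ m → m + m + (y - x)) (ℤP.i≤j⇒i⊔j≡j x≤-y) ⟨
  (x ⊔ - y) + (x ⊔ - y) + (y - x)  ∎
  where
  open ≡-Reasoning
  x+y≤0 : x + y ≤ 0ℤ
  x+y≤0 = ℤP.<⇒≤ (ℤP.≰⇒> 0≰x+y)
  x≤-y : x ≤ - y
  x≤-y = ℤP.0≤i-j⇒j≤i (subst (0ℤ ≤_) (neg-sum x y) (ℤP.neg-mono-≤ x+y≤0))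
    where
    neg-sum : ∀ x y → - (x + y) ≡ - y - x
    neg-sum = solve-∀
  ring : ∀ x y → - (x + y) ≡ - y + - y + (y - x)
  ring = solve-∀

sameSign⇔0<⊔ : ∀ x y → SameSign x y ⇔ (0ℤ < x ⊔ - y × 0ℤ < y ⊔ - x)
sameSign⇔0<⊔ x y = mk⇔ to from
  where
  to : SameSign x y → 0ℤ < x ⊔ - y × 0ℤ < y ⊔ - x
  to (inj₁ (0<x , 0<y)) = ℤP.<-≤-trans 0<x (ℤP.i≤i⊔j x _) , ℤP.<-≤-trans 0<y (ℤP.i≤i⊔j y _)
  to (inj₂ (x<0 , y<0)) = ℤP.<-≤-trans (ℤP.neg-mono-< y<0) (ℤP.i≤j⊔i x _) , ℤP.<-≤-trans (ℤP.neg-mono-< x<0) (ℤP.i≤j⊔i y _)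
  from : 0ℤ < x ⊔ - y × 0ℤ < y ⊔ - x → SameSign x y
  from (0<x⊔-y , 0<y⊔-x) with 0ℤ <? x
  ... | yes 0<x = inj₁ (0<x , 0<⊔⇒0<ˡ 0<y⊔-x (ℤP.<⇒≤ (ℤP.neg-mono-< 0<x)))
  ... | no  0≮x = inj₂ (x<0 , y<0)
    where
    y<0 : y < 0ℤ
    y<0 = 0<-i⇒i<0 (0<⊔⇒0<ʳ 0<x⊔-y (ℤP.≮⇒≥ 0≮x))
    x<0 : x < 0ℤ
    x<0 = 0<-i⇒i<0 (0<⊔⇒0<ʳ 0<y⊔-x (ℤP.<⇒≤ y<0))

-- Integers and half-integers in ℚ; Gamma factors

-- z / 1 normalises to the literal fromℤ z, on which the field operations compute.
⟦⟧≡fromℤ : ∀ z → ⟦ z ⟧ ≡ ℚL.fromℤ z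
⟦⟧≡fromℤ (+ n)    = ℚP.normalize-coprime (Coprimality.sym (Coprimality.1-coprimeTo n))
⟦⟧≡fromℤ -[1+ n ] = cong ℚ.-_ (ℚP.normalize-coprime (Coprimality.sym (Coprimality.1-coprimeTo (suc n))))

⟦⟧-+ : ∀ a b → ⟦ a + b ⟧ ≡ ⟦ a ⟧ ℚ.+ ⟦ b ⟧
⟦⟧-+ a b = sym (sum≡ a b)
  where
  sum≡ : ∀ a b → ⟦ a ⟧ ℚ.+ ⟦ b ⟧ ≡ ⟦ a + b ⟧
  sum≡ a b rewrite ⟦⟧≡fromℤ a | ⟦⟧≡fromℤ b | ⟦⟧≡fromℤ (a + b) =
    trans (cong (ℚ._/ 1) (cong₂ _+_ (ℤP.*-identityʳ a) (ℤP.*-identityʳ b))) (⟦⟧≡fromℤ (a + b))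

⟦⟧-neg : ∀ a → ⟦ - a ⟧ ≡ ℚ.- ⟦ a ⟧
⟦⟧-neg (+ zero)    = refl
⟦⟧-neg (+ suc n)   = refl
⟦⟧-neg -[1+ n ] rewrite ⟦⟧≡fromℤ -[1+ n ] | ⟦⟧≡fromℤ (+ suc n) = refl

⟦⟧-- : ∀ a b → ⟦ a - b ⟧ ≡ ⟦ a ⟧ ℚ.- ⟦ b ⟧
⟦⟧-- a b = trans (⟦⟧-+ a (- b)) (cong (⟦ a ⟧ ℚ.+_) (⟦⟧-neg b))

⟦⟧-∣∣ : ∀ a → ⟦ + ℤ.∣ a ∣ ⟧ ≡ ℚ.∣ ⟦ a ⟧ ∣
⟦⟧-∣∣ a rewrite ⟦⟧≡fromℤ a | ⟦⟧≡fromℤ (+ ℤ.∣ a ∣) = refl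

⟦⟧-mono-≤ : ∀ {a b} → a ≤ b → ⟦ a ⟧ ℚ.≤ ⟦ b ⟧
⟦⟧-mono-≤ {a} {b} a≤b rewrite ⟦⟧≡fromℤ a | ⟦⟧≡fromℤ b =
  ℚ.*≤* (subst₂ _≤_ (sym (ℤP.*-identityʳ a)) (sym (ℤP.*-identityʳ b)) a≤b)

⟦⟧-cancel-≤ : ∀ {a b} → ⟦ a ⟧ ℚ.≤ ⟦ b ⟧ → a ≤ b
⟦⟧-cancel-≤ {a} {b} le rewrite ⟦⟧≡fromℤ a | ⟦⟧≡fromℤ b with le
... | ℚ.*≤* a*1≤b*1 = subst₂ _≤_ (ℤP.*-identityʳ a) (ℤP.*-identityʳ b) a*1≤b*1

⟦⟧-injective : ∀ {a b} → ⟦ a ⟧ ≡ ⟦ b ⟧ → a ≡ b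
⟦⟧-injective eq = ℤP.≤-antisym (⟦⟧-cancel-≤ (ℚP.≤-reflexive eq)) (⟦⟧-cancel-≤ (ℚP.≤-reflexive (sym eq)))

ℚ-ring : ACR.AlmostCommutativeRing 0ℓ 0ℓ
ℚ-ring = ACR.fromCommutativeRing ℚP.+-*-commutativeRing λ x → case-zero (0ℚ ℚP.≟ x)
  where
  case-zero : ∀ {x} → Dec (0ℚ ≡ x) → Maybe (0ℚ ≡ x)
  case-zero (yes p) = just p
  case-zero (no _)  = nothing

half : ℤ → ℚ
half z = ⟦ z ⟧ ℚ.* ½

half-+ : ∀ a b → half (a + b) ≡ half a ℚ.+ half b
half-+ a b = trans (cong (ℚ._* ½) (⟦⟧-+ a b)) (ℚP.*-distribʳ-+ ½ ⟦ a ⟧ ⟦ b ⟧)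

half-neg : ∀ a → half (- a) ≡ ℚ.- half a
half-neg a = trans (cong (ℚ._* ½) (⟦⟧-neg a)) (sym (ℚP.neg-distribˡ-* ⟦ a ⟧ ½))

half-- : ∀ a b → half (a - b) ≡ half a ℚ.- half b
half-- a b = trans (half-+ a (- b)) (cong (half a ℚ.+_) (half-neg b))

half-double : ∀ a → half (a + a) ≡ ⟦ a ⟧
half-double a = begin
  half (a + a)                 ≡⟨ half-+ a a ⟩
  ⟦ a ⟧ ℚ.* ½ ℚ.+ ⟦ a ⟧ ℚ.* ½  ≡⟨ ℚP.*-distribˡ-+ ⟦ a ⟧ ½ ½ ⟨
  ⟦ a ⟧ ℚ.* 1ℚ                 ≡⟨ ℚP.*-identityʳ ⟦ a ⟧ ⟩
  ⟦ a ⟧                        ∎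
  where open ≡-Reasoning

*½-mono-≤ : ∀ {x y} → x ℚ.≤ y → x ℚ.* ½ ℚ.≤ y ℚ.* ½
*½-mono-≤ = ℚP.*-monoʳ-≤-nonNeg ½

*½-cancel-≤ : ∀ {x y} → x ℚ.* ½ ℚ.≤ y ℚ.* ½ → x ℚ.≤ y
*½-cancel-≤ {x} {y} le = subst₂ ℚ._≤_ (undo x) (undo y) (ℚP.*-monoʳ-≤-nonNeg ⟦ + 2 ⟧ le)
  where
  undo : ∀ z → z ℚ.* ½ ℚ.* ⟦ + 2 ⟧ ≡ z
  undo z = trans (ℚP.*-assoc z ½ ⟦ + 2 ⟧) (ℚP.*-identityʳ z)

isPole⇔≤0 : ∀ z → IsPole ⟦ z ⟧ ⇔ z ≤ 0ℤ
isPole⇔≤0 z = mk⇔ to from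
  where
  to : IsPole ⟦ z ⟧ → z ≤ 0ℤ
  to (k , eq) = subst (_≤ 0ℤ) (sym (⟦⟧-injective (trans eq (sym (⟦⟧-neg (+ k)))))) (ℤP.neg-≤-pos {k} {0})
  from : z ≤ 0ℤ → IsPole ⟦ z ⟧
  from z≤0 = ℤ.∣ z ∣ , trans (cong ⟦_⟧ z≡-∣z∣) (⟦⟧-neg (+ ℤ.∣ z ∣))
    where
    z≡-∣z∣ : z ≡ - (+ ℤ.∣ z ∣)
    z≡-∣z∣ = trans (sym (ℤP.neg-involutive z)) (cong -_ (sym (+∣i∣≡-i z≤0)))

-- The Gamma argument s + (a + b)/2 + ∣a - b∣/2 is the integer p.
LFiniteAt⇔0< : ∀ {s} a b S K D p → s ≡ half S → a ℚ.+ b ≡ ⟦ K ⟧ → a ℚ.- b ≡ ⟦ D ⟧ →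
  S + K + + ℤ.∣ D ∣ ≡ p + p → LFiniteAt s a b ⇔ 0ℤ < p
LFiniteAt⇔0< {s} a b S K D p s≡ a+b≡ a-b≡ S+K+∣D∣≡ = mk⇔
  (λ finite → ℤP.≰⇒> λ p≤0 → finite (subst IsPole (sym argument≡) (Equivalence.from (isPole⇔≤0 p) p≤0)))
  (λ 0<p pole → ℤP.<⇒≱ 0<p (Equivalence.to (isPole⇔≤0 p) (subst IsPole argument≡ pole)))
  where
  open ≡-Reasoning
  argument≡ : s ℚ.+ (a ℚ.+ b) ℚ.* ½ ℚ.+ ℚ.∣ a ℚ.- b ∣ ℚ.* ½ ≡ ⟦ p ⟧
  argument≡ = begin
    s ℚ.+ (a ℚ.+ b) ℚ.* ½ ℚ.+ ℚ.∣ a ℚ.- b ∣ ℚ.* ½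
      ≡⟨ cong₂ (λ x y → x ℚ.+ y ℚ.* ½) (cong₂ (λ x y → x ℚ.+ y ℚ.* ½) s≡ a+b≡)
               (trans (cong ℚ.∣_∣ a-b≡) (sym (⟦⟧-∣∣ D))) ⟩
    half S ℚ.+ half K ℚ.+ half (+ ℤ.∣ D ∣)
      ≡⟨ trans (half-+ (S + K) (+ ℤ.∣ D ∣)) (cong (ℚ._+ half (+ ℤ.∣ D ∣)) (half-+ S K)) ⟨
    half (S + K + + ℤ.∣ D ∣)  ≡⟨ cong half S+K+∣D∣≡ ⟩
    half (p + p)              ≡⟨ half-double p ⟩
    ⟦ p ⟧                     ∎

neg-+ : ∀ a b K → a ℚ.+ b ≡ ⟦ K ⟧ → ℚ.- a ℚ.+ ℚ.- b ≡ ⟦ - K ⟧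
neg-+ a b K a+b≡ = trans (sym (ℚP.neg-distrib-+ a b)) (trans (cong ℚ.-_ a+b≡) (sym (⟦⟧-neg K)))

neg-- : ∀ a b D → a ℚ.- b ≡ ⟦ D ⟧ → ℚ.- a ℚ.- ℚ.- b ≡ ⟦ - D ⟧
neg-- a b D a-b≡ = trans (sym (ℚP.neg-distrib-+ a (ℚ.- b))) (trans (cong ℚ.-_ a-b≡) (sym (⟦⟧-neg D)))

p-r≤q⇔p-q≤r : ∀ p q r → p ℚ.- r ℚ.≤ q ⇔ p ℚ.- q ℚ.≤ r
p-r≤q⇔p-q≤r p q r = mk⇔ (swap p q r) (swap p r q)
  where
  swap : ∀ p q r → p ℚ.- r ℚ.≤ q → p ℚ.- q ℚ.≤ r
  swap p q r le = subst₂ ℚ._≤_ (ring₁ p q r) (ring₂ q r) (ℚP.+-monoˡ-≤ (r ℚ.- q) le)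
    where
    ring₁ : ∀ p q r → p ℚ.- r ℚ.+ (r ℚ.- q) ≡ p ℚ.- q
    ring₁ = RingSolver.solve-∀ ℚ-ring
    ring₂ : ∀ q r → q ℚ.+ (r ℚ.- q) ≡ r
    ring₂ = RingSolver.solve-∀ ℚ-ring

p≤q+r⇔p-q≤r : ∀ p q r → p ℚ.≤ q ℚ.+ r ⇔ p ℚ.- q ℚ.≤ r
p≤q+r⇔p-q≤r p q r = mk⇔
  (λ le → subst (p ℚ.- q ℚ.≤_) (ring₁ q r) (ℚP.+-monoˡ-≤ (ℚ.- q) le))
  (λ le → subst₂ ℚ._≤_ (ring₂ p q) (ℚP.+-comm r q) (ℚP.+-monoˡ-≤ q le))
  where
  ring₁ : ∀ q r → q ℚ.+ r ℚ.- q ≡ r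
  ring₁ = RingSolver.solve-∀ ℚ-ring
  ring₂ : ∀ p q → p ℚ.- q ℚ.+ q ≡ p
  ring₂ = RingSolver.solve-∀ ℚ-ring

half≤*½⇔ : ∀ K x → half K ℚ.≤ x ℚ.* ½ ⇔ ⟦ K ⟧ ℚ.≤ x
half≤*½⇔ K x = mk⇔ *½-cancel-≤ *½-mono-≤

-- Counting

indicator : ∀ {a} {A : Set a} → Dec A → ℕ
indicator (yes _) = 1
indicator (no _)  = 0

module _ {a} {A : Set a} where

  indicator-yes : (d : Dec A) → A → indicator d ≡ 1
  indicator-yes (yes _) _ = refl
  indicator-yes (no ¬x) x = contradiction x ¬x

  indicator-no : (d : Dec A) → ¬ A → indicator d ≡ 0
  indicator-no (yes x) ¬x = contradiction x ¬x
  indicator-no (no _)  _  = refl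

  indicator≤1 : (d : Dec A) → indicator d ℕ.≤ 1
  indicator≤1 (yes _) = ℕP.≤-refl
  indicator≤1 (no _)  = ℕ.z≤n

  indicator-cong : ∀ {b} {B : Set b} (d : Dec A) (e : Dec B) → (A → B) → (B → A) → indicator d ≡ indicator e
  indicator-cong (yes _) (yes _) _ _ = refl
  indicator-cong (yes x) (no ¬y) f _ = contradiction (f x) ¬y
  indicator-cong (no ¬x) (yes y) _ g = contradiction (g y) ¬x
  indicator-cong (no _)  (no _)  _ _ = refl

sum-const : ∀ m x → ∑[ k < m ] x ≡ m ℕ.* x
sum-const zero    x = refl
sum-const (suc m) x = cong (x ℕ.+_) (sum-const m x)

sum-zero : ∀ {m} {f : Fin m → ℕ} → (∀ k → f k ≡ 0) → sum f ≡ 0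
sum-zero {m} f≡0 = trans (sum-cong-≗ f≡0) (trans (sum-const m 0) (ℕP.*-zeroʳ m))

sum-mono-≤ : ∀ {m} {f g : Fin m → ℕ} → (∀ k → f k ℕ.≤ g k) → sum f ℕ.≤ sum g
sum-mono-≤ {zero}  f≤g = ℕ.z≤n
sum-mono-≤ {suc m} f≤g = ℕP.+-mono-≤ (f≤g Fin.zero) (sum-mono-≤ (f≤g ∘ Fin.suc))

sum-mono-< : ∀ {m} {f g : Fin m → ℕ} → (∀ k → f k ℕ.≤ g k) → ∀ q → f q ℕ.< g q → sum f ℕ.< sum g
sum-mono-< {suc m} f≤g Fin.zero    fq<gq = ℕP.+-mono-<-≤ fq<gq (sum-mono-≤ (f≤g ∘ Fin.suc))
sum-mono-< {suc m} f≤g (Fin.suc q) fq<gq = ℕP.+-mono-≤-< (f≤g Fin.zero) (sum-mono-< (f≤g ∘ Fin.suc) q fq<gq)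

sum-≡⇒≗ : ∀ {m} {f g : Fin m → ℕ} → (∀ k → f k ℕ.≤ g k) → sum f ≡ sum g → ∀ k → f k ≡ g k
sum-≡⇒≗ {suc m} {f} {g} f≤g eq = λ
  { Fin.zero    → head≡
  ; (Fin.suc k) → sum-≡⇒≗ (f≤g ∘ Fin.suc) (ℕP.+-cancelˡ-≡ (f Fin.zero) _ _ (trans eq (cong (ℕ._+ _) (sym head≡)))) k }
  where
  head≡ : f Fin.zero ≡ g Fin.zero
  head≡ = ℕP.≤-antisym (f≤g Fin.zero) (ℕP.+-cancelʳ-≤ _ _ _
            (ℕP.≤-trans (ℕP.≤-reflexive (sym eq)) (ℕP.+-monoʳ-≤ (f Fin.zero) (sum-mono-≤ (f≤g ∘ Fin.suc)))))

sum-↑ : ∀ m {n} (f : Fin (m ℕ.+ n) → ℕ) → sum f ≡ ∑[ i < m ] f (i ↑ˡ n) ℕ.+ ∑[ j < n ] f (m ↑ʳ j)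
sum-↑ zero    f = refl
sum-↑ (suc m) f = trans (cong (f Fin.zero ℕ.+_) (sum-↑ m (f ∘ Fin.suc))) (sym (ℕP.+-assoc (f Fin.zero) _ _))

module _ {a p} {A : Set a} {P : A → Set p} (P? : Decidable P) where

  length-filter-∷ : ∀ x xs → length (filter P? (x ∷ xs)) ≡ indicator (P? x) ℕ.+ length (filter P? xs)
  length-filter-∷ x xs with P? x
  ... | yes _ = refl
  ... | no _  = refl

  length-filter-++ : ∀ xs ys → length (filter P? (xs List.++ ys)) ≡ length (filter P? xs) ℕ.+ length (filter P? ys)
  length-filter-++ xs ys = trans (cong length (ListP.filter-++ P? xs ys)) (ListP.length-++ (filter P? xs))

  length-filter-tabulate : ∀ {m} (f : Fin m → A) → length (filter P? (tabulate f)) ≡ ∑[ k < m ] indicator (P? (f k))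
  length-filter-tabulate {zero}  f = refl
  length-filter-tabulate {suc m} f =
    trans (length-filter-∷ (f Fin.zero) _) (cong (indicator (P? (f Fin.zero)) ℕ.+_) (length-filter-tabulate (f ∘ Fin.suc)))

module _ {a b p} {A : Set a} {B : Set b} {P : A × B → Set p} (P? : Decidable P) where

  length-filter-cartesianProduct : ∀ {m n} (f : Fin m → A) (g : Fin n → B) →
    length (filter P? (cartesianProduct (tabulate f) (tabulate g))) ≡ ∑[ i < m ] ∑[ j < n ] indicator (P? (f i , g j))
  length-filter-cartesianProduct {zero}  f g = refl
  length-filter-cartesianProduct {suc m} f g = begin
    length (filter P? (map (f Fin.zero ,_) (tabulate g) List.++ cartesianProduct (tabulate (f ∘ Fin.suc)) (tabulate g)))
      ≡⟨ length-filter-++ P? (map (f Fin.zero ,_) (tabulate g)) _ ⟩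
    length (filter P? (map (f Fin.zero ,_) (tabulate g))) ℕ.+ length (filter P? (cartesianProduct (tabulate (f ∘ Fin.suc)) (tabulate g)))
      ≡⟨ cong₂ ℕ._+_ (trans (cong (length ∘ filter P?) (ListP.map-tabulate g (f Fin.zero ,_)))
                          (length-filter-tabulate P? (λ j → f Fin.zero , g j)))
                   (length-filter-cartesianProduct (f ∘ Fin.suc) g) ⟩
    ∑[ j < _ ] indicator (P? (f Fin.zero , g j)) ℕ.+ ∑[ i < m ] ∑[ j < _ ] indicator (P? (f (Fin.suc i) , g j)) ∎
    where open ≡-Reasoning

sum²-≡⇒≗ : ∀ {m m'} {f g : Fin m → Fin m' → ℕ} → (∀ i j → f i j ℕ.≤ g i j) →
  ∑[ i < m ] ∑[ j < m' ] f i j ≡ ∑[ i < m ] ∑[ j < m' ] g i j → ∀ i j → f i j ≡ g i j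
sum²-≡⇒≗ f≤g eq i = sum-≡⇒≗ (f≤g i) (sum-≡⇒≗ (λ i → sum-mono-≤ (f≤g i)) eq i)

sum²-1 : ∀ m m' → ∑[ i < m ] ∑[ j < m' ] 1 ≡ m ℕ.* m'
sum²-1 m m' = trans (sum-cong-≗ {m} λ _ → trans (sum-const m' 1) (ℕP.*-identityʳ m')) (sum-const m m')

signCount : ℤ → ℤ → ℕ
signCount c u = indicator (u + c <? 0ℤ) ℕ.+ indicator (0ℤ <? u)

module _ {c : ℤ} (u : ℤ) where

  signCount≤1 : 0ℤ ≤ c → signCount c u ℕ.≤ 1
  signCount≤1 0≤c with u + c <? 0ℤ | 0ℤ <? u
  ... | yes u+c<0 | yes 0<u = contradiction u+c<0 (ℤP.<-asym (ℤP.+-mono-<-≤ 0<u 0≤c))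
  ... | yes _   | no _      = ℕP.≤-refl
  ... | no _    | yes _     = ℕP.≤-refl
  ... | no _    | no _      = ℕ.z≤n

  1≤signCount : c < 0ℤ → 1 ℕ.≤ signCount c u
  1≤signCount c<0 with u + c <? 0ℤ | 0ℤ <? u
  ... | yes _     | _      = ℕ.s≤s ℕ.z≤n
  ... | no _      | yes _  = ℕP.≤-refl
  ... | no u+c≮0  | no 0≮u = contradiction (ℤP.+-mono-≤-< (ℤP.≮⇒≥ 0≮u) c<0) u+c≮0

  sameSign⇒signCount≡1 : SameSign u (u + c) → signCount c u ≡ 1
  sameSign⇒signCount≡1 (inj₁ (0<u , 0<u+c)) =
    cong₂ ℕ._+_ (indicator-no (u + c <? 0ℤ) (ℤP.<-asym 0<u+c)) (indicator-yes (0ℤ <? u) 0<u)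
  sameSign⇒signCount≡1 (inj₂ (u<0 , u+c<0)) =
    cong₂ ℕ._+_ (indicator-yes (u + c <? 0ℤ) u+c<0) (indicator-no (0ℤ <? u) (ℤP.<-asym u<0))

  signCount≡1⇒sameSign : signCount c u ≡ 1 → u ≢ 0ℤ → u + c ≢ 0ℤ → SameSign u (u + c)
  signCount≡1⇒sameSign count≡1 u≢0 u+c≢0 with u + c <? 0ℤ | 0ℤ <? u
  ... | yes _     | yes _   = contradiction count≡1 λ ()
  ... | no u+c≮0  | yes 0<u = inj₁ (0<u , ℤP.≤∧≢⇒< (ℤP.≮⇒≥ u+c≮0) (u+c≢0 ∘′ sym))
  ... | yes u+c<0 | no 0≮u  = inj₂ (ℤP.≤∧≢⇒< (ℤP.≮⇒≥ 0≮u) u≢0 , u+c<0)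
  ... | no _      | no _    = contradiction count≡1 λ ()

-- Sorting permutations and inversions

StrictlyDecreasing : ∀ {N} → (Fin N → ℤ) → Set
StrictlyDecreasing f = ∀ {k k'} → k Fin.< k' → f k' < f k

module _ {N} (f : Fin N → ℤ) where

  -- For integers, strict decrease means a drop of at least one per step.
  strictlyDecreasing⇔ : StrictlyDecreasing f ⇔
    (∀ k k' → toℕ k ℕ.≤ toℕ k' → f k' + + toℕ k' ≤ f k + + toℕ k)
  strictlyDecreasing⇔ = mk⇔ to from
    where
    from : (∀ k k' → toℕ k ℕ.≤ toℕ k' → f k' + + toℕ k' ≤ f k + + toℕ k) → StrictlyDecreasing f
    from shifted {k} {k'} k<k' =
      +-cancelʳ-< (+ toℕ k') (ℤP.≤-<-trans (shifted k k' (ℕP.<⇒≤ k<k')) (ℤP.+-monoʳ-< (f k) (ℤ.+<+ k<k')))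
    to : StrictlyDecreasing f → ∀ k k' → toℕ k ℕ.≤ toℕ k' → f k' + + toℕ k' ≤ f k + + toℕ k
    to desc k k' k≤k' = go (toℕ k' ℕ.∸ toℕ k) k' (sym (ℕP.m∸n+n≡m k≤k'))
      where
      go : ∀ d k' → toℕ k' ≡ d ℕ.+ toℕ k → f k' + + toℕ k' ≤ f k + + toℕ k
      go zero    k' eq rewrite FinP.toℕ-injective eq = ℤP.≤-refl
      go (suc d) k' eq = ℤP.≤-trans step (go d k'' (FinP.toℕ-fromℕ< d+k<N))
        where
        d+k<N : d ℕ.+ toℕ k ℕ.< N
        d+k<N = ℕP.<-trans (ℕP.n<1+n _) (subst (ℕ._< N) eq (FinP.toℕ<n k'))
        k'' : Fin N
        k'' = fromℕ< d+k<N
        toℕk'≡ : toℕ k' ≡ suc (toℕ k'')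
        toℕk'≡ = trans eq (cong suc (sym (FinP.toℕ-fromℕ< d+k<N)))
        step : f k' + + toℕ k' ≤ f k'' + + toℕ k''
        step = subst (λ t → f k' + + t ≤ f k'' + + toℕ k'') (sym toℕk'≡)
                 (subst (_≤ f k'' + + toℕ k'') (shift (f k') (+ toℕ k''))
                   (ℤP.+-monoˡ-≤ (+ toℕ k'') (ℤP.i<j⇒suc[i]≤j (desc (subst (toℕ k'' ℕ.<_) (sym toℕk'≡) (ℕP.n<1+n _))))))
          where
          shift : ∀ a t → + 1 + a + t ≡ a + (+ 1 + t)
          shift = solve-∀

strictlyDecreasing⇒injective : ∀ {N} {f : Fin N → ℤ} → StrictlyDecreasing f → Injective _≡_ _≡_ f
strictlyDecreasing⇒injective f↓ {k} {k'} fk≡fk' with ℕP.<-cmp (toℕ k) (toℕ k')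
... | tri< lt _ _ = contradiction (f↓ lt) (ℤP.<-irrefl (sym fk≡fk'))
... | tri≈ _ eq _ = FinP.toℕ-injective eq
... | tri> _ _ gt = contradiction (f↓ gt) (ℤP.<-irrefl fk≡fk')

inversions : ∀ {N} → (Fin N → ℤ) → ℕ
inversions {N} E = ∑[ p < N ] ∑[ q < N ] indicator ((q Fin.<? p) ×-dec (E q <? E p))

module _ {N} (E : Fin N → ℤ) (w : Permutation′ N) (desc : StrictlyDecreasing (E ∘ (w ⟨$⟩ʳ_))) where

  descending-reverses-order : ∀ {p q} → E q < E p → w ⟨$⟩ˡ p Fin.< w ⟨$⟩ˡ q
  descending-reverses-order {p} {q} Eq<Ep with ℕP.<-cmp (toℕ (w ⟨$⟩ˡ p)) (toℕ (w ⟨$⟩ˡ q))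
  ... | tri< lt _ _ = lt
  ... | tri≈ _ eq _ = contradiction Eq<Ep (ℤP.<-irrefl (cong E (sym p≡q)))
    where
    p≡q : p ≡ q
    p≡q = trans (sym (inverseʳ w)) (trans (cong (w ⟨$⟩ʳ_) (FinP.toℕ-injective eq)) (inverseʳ w))
  ... | tri> _ _ gt = contradiction (subst₂ _<_ (cong E (inverseʳ w)) (cong E (inverseʳ w)) (desc gt)) (ℤP.<-asym Eq<Ep)

  descending⇒injective : Injective _≡_ _≡_ E
  descending⇒injective {p} {q} Ep≡Eq = trans (sym (inverseʳ w)) (trans (cong (w ⟨$⟩ʳ_)
    (strictlyDecreasing⇒injective desc (trans (cong E (inverseʳ w)) (trans Ep≡Eq (cong E (sym (inverseʳ w))))))) (inverseʳ w))

  -- Reindexing by w⁻¹ turns the inversions of w into those of E.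
  len≡inversions : len w ≡ inversions E
  len≡inversions = begin
    len w
      ≡⟨ length-filter-cartesianProduct inverted? (λ k → k) (λ k → k) ⟩
    ∑[ k < N ] ∑[ k' < N ] indicator (inverted? (k , k'))
      ≡⟨ sum-permute (λ k → ∑[ k' < N ] indicator (inverted? (k , k'))) (inv w) ⟩
    ∑[ p < N ] ∑[ k' < N ] indicator (inverted? (w ⟨$⟩ˡ p , k'))
      ≡⟨ sum-cong-≗ (λ p → sum-permute (λ k' → indicator (inverted? (w ⟨$⟩ˡ p , k'))) (inv w)) ⟩
    ∑[ p < N ] ∑[ q < N ] indicator (inverted? (w ⟨$⟩ˡ p , w ⟨$⟩ˡ q))
      ≡⟨ sum-cong-≗ (λ p → sum-cong-≗ (λ q → indicator-cong _ _ (to {p} {q}) (from {p} {q}))) ⟩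
    inversions E ∎
    where
    open ≡-Reasoning
    Inverted : Fin N → Fin N → Set
    Inverted k k' = (k Fin.< k') × (w ⟨$⟩ʳ k' Fin.< w ⟨$⟩ʳ k)
    inverted? : (x : Fin N × Fin N) → Dec (Inverted (proj₁ x) (proj₂ x))
    inverted? x = (proj₁ x Fin.<? proj₂ x) ×-dec ((w ⟨$⟩ʳ proj₂ x) Fin.<? (w ⟨$⟩ʳ proj₁ x))
    to : ∀ {p q} → Inverted (w ⟨$⟩ˡ p) (w ⟨$⟩ˡ q) → (q Fin.< p) × (E q < E p)
    to (lt , lt') = subst₂ Fin._<_ (inverseʳ w) (inverseʳ w) lt'
                  , subst₂ _<_ (cong E (inverseʳ w)) (cong E (inverseʳ w)) (desc lt)
    from : ∀ {p q} → (q Fin.< p) × (E q < E p) → Inverted (w ⟨$⟩ˡ p) (w ⟨$⟩ˡ q)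
    from (q<p , Eq<Ep) = descending-reverses-order Eq<Ep , subst₂ Fin._<_ (sym (inverseʳ w)) (sym (inverseʳ w)) q<p

injective⇒surjective : ∀ {n} {f : Fin n → Fin n} → Injective _≡_ _≡_ f → ∀ k → ∃ λ p → f p ≡ k
injective⇒surjective {suc n} {f} f-injective k with FinP.any? (λ p → f p FinP.≟ k)
... | yes found = found
... | no ¬found = contradiction (FinP.injective⇒≤ punchOut∘f-injective) ℕP.1+n≰n
  where
  punchOut∘f : Fin (suc n) → Fin n
  punchOut∘f p = Fin.punchOut {i = k} {j = f p} (λ k≡fp → ¬found (p , sym k≡fp))
  punchOut∘f-injective : Injective _≡_ _≡_ punchOut∘f
  punchOut∘f-injective eq = f-injective (FinP.punchOut-injective {i = k} _ _ eq)

-- Position p at its rank, the number of entries larger than E p.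
module _ {N} (E : Fin N → ℤ) (E-injective : Injective _≡_ _≡_ E) where

  private
    rank : Fin N → ℕ
    rank p = ∑[ r < N ] indicator (E p <? E r)

    rank<N : ∀ p → rank p ℕ.< N
    rank<N p = subst (rank p ℕ.<_) (trans (sum-const N 1) (ℕP.*-identityʳ N))
      (sum-mono-< (λ r → indicator≤1 (E p <? E r)) p
        (subst (ℕ._< 1) (sym (indicator-no (E p <? E p) (ℤP.<-irrefl refl))) (ℕ.s≤s ℕ.z≤n)))

    rank-antitone : ∀ {p q} → E q < E p → rank p ℕ.< rank q
    rank-antitone {p} {q} Eq<Ep = sum-mono-< larger p
      (subst₂ ℕ._<_ (sym (indicator-no (E p <? E p) (ℤP.<-irrefl refl))) (sym (indicator-yes (E q <? E p) Eq<Ep)) (ℕ.s≤s ℕ.z≤n))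
      where
      larger : ∀ r → indicator (E p <? E r) ℕ.≤ indicator (E q <? E r)
      larger r with E p <? E r
      ... | yes Ep<Er = ℕP.≤-reflexive (sym (indicator-yes (E q <? E r) (ℤP.<-trans Eq<Ep Ep<Er)))
      ... | no _      = ℕ.z≤n

    rankFin : Fin N → Fin N
    rankFin p = fromℕ< (rank<N p)

    toℕ-rankFin : ∀ p → toℕ (rankFin p) ≡ rank p
    toℕ-rankFin p = FinP.toℕ-fromℕ< (rank<N p)

    rank-<⇒> : ∀ p q → rank p ℕ.< rank q → E q < E p
    rank-<⇒> p q rp<rq with ℤP.<-cmp (E p) (E q)
    ... | tri< Ep<Eq _ _ = contradiction rp<rq (ℕP.<-asym (rank-antitone Ep<Eq))
    ... | tri≈ _ Ep≡Eq _ = contradiction (subst (λ x → rank x ℕ.< rank q) (E-injective Ep≡Eq) rp<rq) (ℕP.<-irrefl refl)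
    ... | tri> _ _ Eq<Ep = Eq<Ep

    rank-injective : ∀ {p q} → rank p ≡ rank q → p ≡ q
    rank-injective {p} {q} rp≡rq with ℤP.<-cmp (E p) (E q)
    ... | tri< Ep<Eq _ _ = contradiction (rank-antitone Ep<Eq) (ℕP.<-irrefl (sym rp≡rq))
    ... | tri≈ _ Ep≡Eq _ = E-injective Ep≡Eq
    ... | tri> _ _ Eq<Ep = contradiction (rank-antitone Eq<Ep) (ℕP.<-irrefl rp≡rq)

    rankFin-injective : Injective _≡_ _≡_ rankFin
    rankFin-injective {p} {q} eq = rank-injective (trans (sym (toℕ-rankFin p)) (trans (cong toℕ eq) (toℕ-rankFin q)))

    unrank : Fin N → Fin N
    unrank k = proj₁ (injective⇒surjective rankFin-injective k)

    rankFin∘unrank : ∀ k → rankFin (unrank k) ≡ k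
    rankFin∘unrank k = proj₂ (injective⇒surjective rankFin-injective k)

  sortingPermutation : Permutation′ N
  sortingPermutation = permutation unrank rankFin (λ p → rankFin-injective (rankFin∘unrank (rankFin p))) rankFin∘unrank

  sortingPermutation-descending : StrictlyDecreasing (E ∘ (sortingPermutation ⟨$⟩ʳ_))
  sortingPermutation-descending {k} {k'} k<k' = rank-<⇒> (unrank k) (unrank k')
    (subst₂ ℕ._<_ (rank-unrank k) (rank-unrank k') k<k')
    where
    rank-unrank : ∀ k → toℕ k ≡ rank (unrank k)
    rank-unrank k = trans (cong toℕ (sym (rankFin∘unrank k))) (toℕ-rankFin (unrank k))

data Split (n n' : ℕ) : Fin (n ℕ.+ n') → Set where
  left  : (i : Fin n)  → Split n n' (i ↑ˡ n')
  right : (j : Fin n') → Split n n' (n ↑ʳ j)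

split : ∀ n n' p → Split n n' p
split n n' p with splitAt n p in eq
... | inj₁ i = subst (Split n n') (FinP.splitAt⁻¹-↑ˡ eq) (left i)
... | inj₂ j = subst (Split n n') (FinP.splitAt⁻¹-↑ʳ eq) (right j)

↑ˡ<↑ʳ : ∀ {n n'} (i : Fin n) (j : Fin n') → i ↑ˡ n' Fin.< n ↑ʳ j
↑ˡ<↑ʳ {n} {n'} i j = subst₂ ℕ._<_ (sym (FinP.toℕ-↑ˡ i n')) (sym (FinP.toℕ-↑ʳ n j))
                       (ℕP.<-≤-trans (FinP.toℕ<n i) (ℕP.m≤m+n n (toℕ j)))

module _ {n n'} (f : Fin n → ℤ) (g : Fin n' → ℤ) (f↓ : StrictlyDecreasing f) (g↓ : StrictlyDecreasing g) where

  private
    E = f ++ g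

    E-↑ˡ : ∀ i → E (i ↑ˡ n') ≡ f i
    E-↑ˡ = lookup-++ˡ f g

    E-↑ʳ : ∀ j → E (n ↑ʳ j) ≡ g j
    E-↑ʳ = lookup-++ʳ f g

    inversion? : ∀ p q → Dec ((q Fin.< p) × (E q < E p))
    inversion? p q = (q Fin.<? p) ×-dec (E q <? E p)

    no-inversion : ∀ {p q} → (q Fin.< p → E p < E q) → indicator (inversion? p q) ≡ 0
    no-inversion reversed = indicator-no (inversion? _ _) λ (q<p , Eq<Ep) → ℤP.<-asym Eq<Ep (reversed q<p)

    left-left : ∀ i i' → indicator (inversion? (i ↑ˡ n') (i' ↑ˡ n')) ≡ 0
    left-left i i' = no-inversion λ q<p → subst₂ _<_ (sym (E-↑ˡ i)) (sym (E-↑ˡ i'))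
      (f↓ (subst₂ ℕ._<_ (FinP.toℕ-↑ˡ i' n') (FinP.toℕ-↑ˡ i n') q<p))

    left-right : ∀ i j → indicator (inversion? (i ↑ˡ n') (n ↑ʳ j)) ≡ 0
    left-right i j = no-inversion λ q<p → contradiction q<p (ℕP.<-asym (↑ˡ<↑ʳ i j))

    right-left : ∀ j i → indicator (inversion? (n ↑ʳ j) (i ↑ˡ n')) ≡ indicator (f i <? g j)
    right-left j i = indicator-cong _ _
      (λ (_ , lt) → subst₂ _<_ (E-↑ˡ i) (E-↑ʳ j) lt)
      (λ lt → ↑ˡ<↑ʳ i j , subst₂ _<_ (sym (E-↑ˡ i)) (sym (E-↑ʳ j)) lt)

    right-right : ∀ j j' → indicator (inversion? (n ↑ʳ j) (n ↑ʳ j')) ≡ 0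
    right-right j j' = no-inversion λ q<p → subst₂ _<_ (sym (E-↑ʳ j)) (sym (E-↑ʳ j'))
      (g↓ (ℕP.+-cancelˡ-< n _ _ (subst₂ ℕ._<_ (FinP.toℕ-↑ʳ n j') (FinP.toℕ-↑ʳ n j) q<p)))

  inversions-++ : inversions (f ++ g) ≡ ∑[ i < n ] ∑[ j < n' ] indicator (f i <? g j)
  inversions-++ = begin
    ∑[ p < n ℕ.+ n' ] ∑[ q < n ℕ.+ n' ] indicator (inversion? p q)
      ≡⟨ sum-↑ n _ ⟩
    ∑[ i < n ] ∑[ q < n ℕ.+ n' ] indicator (inversion? (i ↑ˡ n') q)
      ℕ.+ ∑[ j < n' ] ∑[ q < n ℕ.+ n' ] indicator (inversion? (n ↑ʳ j) q)
      ≡⟨ cong₂ ℕ._+_ (sum-zero λ i → trans (sum-↑ n _) (cong₂ ℕ._+_ (sum-zero (left-left i)) (sum-zero (left-right i))))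
                     (sum-cong-≗ λ j → trans (sum-↑ n _) (cong₂ ℕ._+_ (sum-cong-≗ (right-left j)) (sum-zero (right-right j)))) ⟩
    ∑[ j < n' ] (∑[ i < n ] indicator (f i <? g j) ℕ.+ 0)
      ≡⟨ sum-cong-≗ (λ j → ℕP.+-identityʳ (∑[ i < n ] indicator (f i <? g j))) ⟩
    ∑[ j < n' ] ∑[ i < n ] indicator (f i <? g j)
      ≡⟨ ∑-comm (λ j i → indicator (f i <? g j)) ⟩
    ∑[ i < n ] ∑[ j < n' ] indicator (f i <? g j) ∎
    where open ≡-Reasoning

  ++-injective : (∀ i j → f i ≢ g j) → Injective _≡_ _≡_ (f ++ g)
  ++-injective f≢g {p} {q} Ep≡Eq with split n n' p | split n n' q
  ... | left i  | left i'  = cong (_↑ˡ n') (strictlyDecreasing⇒injective f↓ (trans (sym (E-↑ˡ i)) (trans Ep≡Eq (E-↑ˡ i'))))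
  ... | left i  | right j  = contradiction (trans (sym (E-↑ˡ i)) (trans Ep≡Eq (E-↑ʳ j))) (f≢g i j)
  ... | right j | left i   = contradiction (trans (sym (E-↑ˡ i)) (trans (sym Ep≡Eq) (E-↑ʳ j))) (f≢g i j)
  ... | right j | right j' = cong (n ↑ʳ_) (strictlyDecreasing⇒injective g↓ (trans (sym (E-↑ʳ j)) (trans Ep≡Eq (E-↑ʳ j'))))

  descending⇒InWP0 : ∀ (w : Permutation′ (n ℕ.+ n')) → StrictlyDecreasing ((f ++ g) ∘ (w ⟨$⟩ʳ_)) → InWP0 n n' w
  descending⇒InWP0 w desc =
    (λ i i' i<i' → descending-reverses-order E w desc (subst₂ _<_ (sym (E-↑ˡ i')) (sym (E-↑ˡ i)) (f↓ i<i'))) ,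
    (λ j j' j<j' → descending-reverses-order E w desc (subst₂ _<_ (sym (E-↑ʳ j')) (sym (E-↑ʳ j)) (g↓ j<j')))

++-injective⇒≢ : ∀ {n n'} {f : Fin n → ℤ} {g : Fin n' → ℤ} → Injective _≡_ _≡_ (f ++ g) → ∀ i j → f i ≢ g j
++-injective⇒≢ {n} {n'} {f} {g} injective i j fi≡gj =
  ℕP.<-irrefl (cong toℕ (injective (trans (lookup-++ˡ f g i) (trans fi≡gj (sym (lookup-++ʳ f g j)))))) (↑ˡ<↑ʳ i j)

private
  module Extrema = Data.List.Extrema (DecTotalOrder.totalOrder ℚP.≤-decTotalOrder)

≤minList⇔ : ∀ {t} (L : List ℚ) → L ≢ [] → t ℚ.≤ minList L ⇔ All (t ℚ.≤_) L
≤minList⇔ []       L≢[] = contradiction refl L≢[]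
≤minList⇔ (x ∷ xs) _    = mk⇔
  (λ t≤min → ℚP.≤-trans t≤min (Extrema.min≤⊤ x xs) ∷ All.map (ℚP.≤-trans t≤min) (Extrema.min≤xs x xs))
  (λ { (t≤x ∷ t≤xs) → Extrema.v≤min⁺ t≤x t≤xs })

All-triples⇔ : ∀ {r n n'} {P : Fin r × Fin n × Fin n' → Set} → All P (triples r n n') ⇔ (∀ v i j → P (v , i , j))
All-triples⇔ = mk⇔
  (λ all v i j → AllP.tabulate⁻ (AllP.map⁻ (AllP.tabulate⁻ (AllP.map⁻
                   (AllP.concat⁻ (AllP.tabulate⁻ (AllP.map⁻ (AllP.concat⁻ all)) v))) i)) j)
  (λ f → AllP.concat⁺ (AllP.map⁺ (AllP.tabulate⁺ λ v →
           AllP.concat⁺ (AllP.map⁺ (AllP.tabulate⁺ λ i → AllP.map⁺ (AllP.tabulate⁺ (f v i)))))))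

-- Strongly pure weights

module _ {r} {A : AutAction r} {m} (ν : StronglyPureWeight r A m) where
  open AutAction A

  shifted : Emb r → Fin m → ℤ
  shifted η i = b ν η i - + toℕ i

  shifted-strictlyDecreasing : ∀ η → StrictlyDecreasing (shifted η)
  shifted-strictlyDecreasing η {i} {i'} i<i' =
    ℤP.+-mono-≤-< (dominant ν η i i' (ℕP.<⇒≤ i<i')) (ℤP.neg-mono-< (ℤ.+<+ i<i'))

  purity : ∀ v i → b ν (v , false) i + b ν (v , true) (opposite i) ≡ 𝗐 ν
  purity v i = subst₂ (λ η η̄ → b ν η i + b ν η̄ (opposite i) ≡ 𝗐 ν) (act-id (v , false)) (act-id (v , true))
                      (pure ν idAut (v , false) i)

  α+β : ∀ v i → α ν v i ℚ.+ β ν v i ≡ ℚ.- ⟦ 𝗐 ν ⟧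
  α+β v i = begin
    (ℚ.- ⟦ B ⟧ ℚ.+ X ℚ.* ½) ℚ.+ (ℚ.- ⟦ B̄ ⟧ ℚ.- X ℚ.* ½)  ≡⟨ cancel ⟦ B ⟧ ⟦ B̄ ⟧ (X ℚ.* ½) ⟩
    ℚ.- (⟦ B̄ ⟧ ℚ.+ ⟦ B ⟧)                               ≡⟨ cong ℚ.-_ (⟦⟧-+ B̄ B) ⟨
    ℚ.- ⟦ B̄ + B ⟧                                       ≡⟨ cong (ℚ.-_ ∘′ ⟦_⟧) (purity v i) ⟩
    ℚ.- ⟦ 𝗐 ν ⟧                                         ∎
    where
    open ≡-Reasoning
    B = b ν (v , true) (opposite i)
    B̄ = b ν (v , false) i
    X = ⟦ + m ⟧ ℚ.- ⟦ + (1 ℕ.+ 2 ℕ.* toℕ i) ⟧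
    cancel : ∀ x y z → (ℚ.- x ℚ.+ z) ℚ.+ (ℚ.- y ℚ.- z) ≡ ℚ.- (y ℚ.+ x)
    cancel = RingSolver.solve-∀ ℚ-ring

  α-β : ∀ v i → α ν v i ℚ.- β ν v i ≡ ⟦ shifted (v , false) i + shifted (v , false) i - 𝗐 ν + (+ m - + 1) ⟧
  α-β v i = begin
    (ℚ.- ⟦ B ⟧ ℚ.+ X ℚ.* ½) ℚ.- (ℚ.- ⟦ B̄ ⟧ ℚ.- X ℚ.* ½)  ≡⟨ collect ⟦ B ⟧ ⟦ B̄ ⟧ X ½ ⟩
    ⟦ B̄ ⟧ ℚ.- ⟦ B ⟧ ℚ.+ X ℚ.* (½ ℚ.+ ½)                 ≡⟨ cong (⟦ B̄ ⟧ ℚ.- ⟦ B ⟧ ℚ.+_) (ℚP.*-identityʳ X) ⟩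
    ⟦ B̄ ⟧ ℚ.- ⟦ B ⟧ ℚ.+ (⟦ + m ⟧ ℚ.- ⟦ u ⟧)             ≡⟨ cong₂ ℚ._+_ (⟦⟧-- B̄ B) (⟦⟧-- (+ m) u) ⟨
    ⟦ B̄ - B ⟧ ℚ.+ ⟦ + m - u ⟧                           ≡⟨ ⟦⟧-+ (B̄ - B) (+ m - u) ⟨
    ⟦ B̄ - B + (+ m - u) ⟧                               ≡⟨ cong (λ t → ⟦ B̄ - B + (+ m - t) ⟧) u≡ ⟩
    ⟦ B̄ - B + (+ m - (+ 1 + (+ toℕ i + + toℕ i))) ⟧     ≡⟨ cong ⟦_⟧ (double-shift B̄ B (+ m) (+ toℕ i)) ⟩
    ⟦ s + s - (B̄ + B) + (+ m - + 1) ⟧                   ≡⟨ cong (λ W → ⟦ s + s - W + (+ m - + 1) ⟧) (purity v i) ⟩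
    ⟦ s + s - 𝗐 ν + (+ m - + 1) ⟧                       ∎
    where
    open ≡-Reasoning
    B = b ν (v , true) (opposite i)
    B̄ = b ν (v , false) i
    s = shifted (v , false) i
    u = + (1 ℕ.+ 2 ℕ.* toℕ i)
    X = ⟦ + m ⟧ ℚ.- ⟦ u ⟧
    u≡ : u ≡ + 1 + (+ toℕ i + + toℕ i)
    u≡ = cong (λ k → + suc (toℕ i ℕ.+ k)) (ℕP.+-identityʳ (toℕ i))
    collect : ∀ x y z h → (ℚ.- x ℚ.+ z ℚ.* h) ℚ.- (ℚ.- y ℚ.- z ℚ.* h) ≡ y ℚ.- x ℚ.+ z ℚ.* (h ℚ.+ h)
    collect = RingSolver.solve-∀ ℚ-ring
    double-shift : ∀ B̄ B m t → B̄ - B + (m - (+ 1 + (t + t))) ≡ B̄ - t + (B̄ - t) - (B̄ + B) + (m - + 1)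
    double-shift = solve-∀

  shifted-opposite : ∀ v i → shifted (v , true) (opposite i) ≡ 𝗐 ν - shifted (v , false) i - (+ m - + 1)
  shifted-opposite v i = begin
    B - + toℕ (opposite i)                     ≡⟨ cong (λ t → B - t) toℕ-opposite ⟩
    B - (+ m - + 1 - + toℕ i)                  ≡⟨ reflect B̄ B (+ m) (+ toℕ i) ⟩
    (B̄ + B) - (B̄ - + toℕ i) - (+ m - + 1)      ≡⟨ cong (λ W → W - (B̄ - + toℕ i) - (+ m - + 1)) (purity v i) ⟩
    𝗐 ν - shifted (v , false) i - (+ m - + 1)  ∎
    where
    open ≡-Reasoning
    B = b ν (v , true) (opposite i)
    B̄ = b ν (v , false) i
    toℕ-opposite : + toℕ (opposite i) ≡ + m - + 1 - + toℕ i
    toℕ-opposite = begin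
      + toℕ (opposite i)                                     ≡⟨ add-sub (+ toℕ (opposite i)) (+ toℕ i) ⟩
      + toℕ (opposite i) + (+ 1 + + toℕ i) - + 1 - + toℕ i  ≡⟨ cong (λ k → k - + 1 - + toℕ i) opposite+suc ⟩
      + m - + 1 - + toℕ i                                    ∎
      where
      opposite+suc : + toℕ (opposite i) + (+ 1 + + toℕ i) ≡ + m
      opposite+suc = cong +_ (trans (cong (ℕ._+ suc (toℕ i)) (FinP.opposite-prop i)) (ℕP.m∸n+n≡m (FinP.toℕ<n i)))
      add-sub : ∀ o t → o ≡ o + (+ 1 + t) - + 1 - t
      add-sub = solve-∀
    reflect : ∀ B̄ B m t → B - (m - + 1 - t) ≡ (B̄ + B) - (B̄ - t) - (m - + 1)
    reflect = solve-∀

module WeightPair {r} {A : AutAction r} {n n'} (μ : StronglyPureWeight r A n) (μ' : StronglyPureWeight r A n') where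

  N : ℕ
  N = n ℕ.+ n'

  c : ℤ
  c = 𝗐 μ - 𝗐 μ' + + N

  rightBlock : Emb r → Fin n' → ℤ
  rightBlock η j = shifted μ' η j - + n

  rightBlock-strictlyDecreasing : ∀ η → StrictlyDecreasing (rightBlock η)
  rightBlock-strictlyDecreasing η j<j' = ℤP.+-monoˡ-< (- + n) (shifted-strictlyDecreasing μ' η j<j')

  gap : Emb r → Fin n → Fin n' → ℤ
  gap η i j = rightBlock η j - shifted μ η i

  GapsSameSign : Set
  GapsSameSign = ∀ v i j → SameSign (gap (v , false) i j) (gap (v , false) i j + c)

  gap-opposite : ∀ v i j → gap (v , true) (opposite i) (opposite j) ≡ - (gap (v , false) i j + c)
  gap-opposite v i j = begin
    (shifted μ' (v , true) (opposite j) - + n) - shifted μ (v , true) (opposite i)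
      ≡⟨ cong₂ (λ x y → (x - + n) - y) (shifted-opposite μ' v j) (shifted-opposite μ v i) ⟩
    (𝗐 μ' - shifted μ' (v , false) j - (+ n' - + 1) - + n) - (𝗐 μ - shifted μ (v , false) i - (+ n - + 1))
      ≡⟨ reflect (shifted μ (v , false) i) (shifted μ' (v , false) j) (𝗐 μ) (𝗐 μ') (+ n) (+ n') ⟩
    - (gap (v , false) i j + c) ∎
    where
    open ≡-Reasoning
    reflect : ∀ s s' W W' m m' → (W' - s' - (m' - + 1) - m) - (W - s - (m - + 1))
                                 ≡ - ((s' - m) - s + (W - W' + (m + m')))
    reflect = solve-∀

  module _ (v : Fin r) (i : Fin n) (j : Fin n') where

    private
      u = gap (v , false) i j
      ē = shifted μ (v , false) i
      ē' = shifted μ' (v , false) j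

    2u+c : ℤ
    2u+c = u + (u + c)

    spread : ℤ
    spread = + ℤ.∣ 2u+c ∣

    lower upper : ℤ
    lower = u ⊔ - (u + c)
    upper = (u + c) ⊔ - u

    spread≡lower : spread ≡ lower + lower + c
    spread≡lower = trans (∣+∣≡⊔-double u (u + c)) (cong (λ d → lower + lower + d) (diff u c))
      where
      diff : ∀ u c → u + c - u ≡ c
      diff = solve-∀

    spread≡upper : spread ≡ upper + upper - c
    spread≡upper = trans (cong (λ x → + ℤ.∣ x ∣) (ℤP.+-comm u (u + c)))
                   (trans (∣+∣≡⊔-double (u + c) u) (cong (λ d → upper + upper + d) (diff u c)))
      where
      diff : ∀ u c → u - (u + c) ≡ - c
      diff = solve-∀

    Δα Δβ : ℚ
    Δα = α μ v i ℚ.- α μ' v j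
    Δβ = β μ v i ℚ.- β μ' v j

    Δα+Δβ : Δα ℚ.+ Δβ ≡ ⟦ 𝗐 μ' - 𝗐 μ ⟧
    Δα+Δβ = begin
      (α μ v i ℚ.- α μ' v j) ℚ.+ (β μ v i ℚ.- β μ' v j) ≡⟨ regroup (α μ v i) (α μ' v j) (β μ v i) (β μ' v j) ⟩
      (α μ v i ℚ.+ β μ v i) ℚ.- (α μ' v j ℚ.+ β μ' v j) ≡⟨ cong₂ ℚ._-_ (α+β μ v i) (α+β μ' v j) ⟩
      ℚ.- ⟦ 𝗐 μ ⟧ ℚ.- ℚ.- ⟦ 𝗐 μ' ⟧                       ≡⟨ swap ⟦ 𝗐 μ ⟧ ⟦ 𝗐 μ' ⟧ ⟩
      ⟦ 𝗐 μ' ⟧ ℚ.- ⟦ 𝗐 μ ⟧                               ≡⟨ ⟦⟧-- (𝗐 μ') (𝗐 μ) ⟨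
      ⟦ 𝗐 μ' - 𝗐 μ ⟧                                     ∎
      where
      open ≡-Reasoning
      regroup : ∀ x x' y y' → (x ℚ.- x') ℚ.+ (y ℚ.- y') ≡ (x ℚ.+ y) ℚ.- (x' ℚ.+ y')
      regroup = RingSolver.solve-∀ ℚ-ring
      swap : ∀ w w' → ℚ.- w ℚ.- ℚ.- w' ≡ w' ℚ.- w
      swap = RingSolver.solve-∀ ℚ-ring

    Δα-Δβ : Δα ℚ.- Δβ ≡ ⟦ - 2u+c ⟧
    Δα-Δβ = begin
      (α μ v i ℚ.- α μ' v j) ℚ.- (β μ v i ℚ.- β μ' v j) ≡⟨ regroup (α μ v i) (α μ' v j) (β μ v i) (β μ' v j) ⟩
      (α μ v i ℚ.- β μ v i) ℚ.- (α μ' v j ℚ.- β μ' v j) ≡⟨ cong₂ ℚ._-_ (α-β μ v i) (α-β μ' v j) ⟩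
      ⟦ T ⟧ ℚ.- ⟦ T' ⟧                                   ≡⟨ ⟦⟧-- T T' ⟨
      ⟦ T - T' ⟧                                         ≡⟨ cong ⟦_⟧ (spread-out ē ē' (𝗐 μ) (𝗐 μ') (+ n) (+ n')) ⟩
      ⟦ - 2u+c ⟧                                         ∎
      where
      open ≡-Reasoning
      T = ē + ē - 𝗐 μ + (+ n - + 1)
      T' = ē' + ē' - 𝗐 μ' + (+ n' - + 1)
      regroup : ∀ x x' y y' → (x ℚ.- x') ℚ.- (y ℚ.- y') ≡ (x ℚ.- y) ℚ.- (x' ℚ.- y')
      regroup = RingSolver.solve-∀ ℚ-ring
      spread-out : ∀ s s' W W' m m' →
        (s + s - W + (m - + 1)) - (s' + s' - W' + (m' - + 1))
        ≡ - ((s' - m - s) + ((s' - m - s) + (W - W' + (m + m'))))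
      spread-out = solve-∀

  critical⇔ : ∀ e → Critical μ μ' (half (e + e - + N)) ⇔
    (∀ v i j → 0ℤ < lower v i j + e × 0ℤ < upper v i j + (+ 1 - e))
  critical⇔ e = mk⇔
    (λ (_ , finite , finite-dual) v i j →
       Equivalence.to (at-M v i j) (finite v i j) , Equivalence.to (at-1-M v i j) (finite-dual v i j))
    (λ positive →
       (e - + N , half-integral) ,
       (λ v i j → Equivalence.from (at-M v i j) (proj₁ (positive v i j))) ,
       (λ v i j → Equivalence.from (at-1-M v i j) (proj₂ (positive v i j))))
    where
    M = e + e - + N
    open ≡-Reasoning

    half-integral : half M ≡ ⟦ + N ⟧ ℚ.* ½ ℚ.+ ⟦ e - + N ⟧
    half-integral = begin
      half M                                       ≡⟨ cong half (regroup e (+ N)) ⟩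
      half (+ N + ((e - + N) + (e - + N)))         ≡⟨ half-+ (+ N) ((e - + N) + (e - + N)) ⟩
      half (+ N) ℚ.+ half ((e - + N) + (e - + N))  ≡⟨ cong (half (+ N) ℚ.+_) (half-double (e - + N)) ⟩
      ⟦ + N ⟧ ℚ.* ½ ℚ.+ ⟦ e - + N ⟧                ∎
      where
      regroup : ∀ e N → e + e - N ≡ N + ((e - N) + (e - N))
      regroup = solve-∀

    at-M : ∀ v i j → LFiniteAt (half M) (Δα v i j) (Δβ v i j) ⇔ 0ℤ < lower v i j + e
    at-M v i j = LFiniteAt⇔0< (Δα v i j) (Δβ v i j) M (𝗐 μ' - 𝗐 μ) (- 2u+c v i j) (L + e)
                   refl (Δα+Δβ v i j) (Δα-Δβ v i j) argument≡
      where
      L = lower v i j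
      argument≡ : M + (𝗐 μ' - 𝗐 μ) + + ℤ.∣ - 2u+c v i j ∣ ≡ (L + e) + (L + e)
      argument≡ = begin
        M + (𝗐 μ' - 𝗐 μ) + + ℤ.∣ - 2u+c v i j ∣
          ≡⟨ cong (λ t → M + (𝗐 μ' - 𝗐 μ) + + t) (ℤP.∣-i∣≡∣i∣ (2u+c v i j)) ⟩
        M + (𝗐 μ' - 𝗐 μ) + spread v i j         ≡⟨ cong (λ t → M + (𝗐 μ' - 𝗐 μ) + t) (spread≡lower v i j) ⟩
        M + (𝗐 μ' - 𝗐 μ) + (L + L + c)          ≡⟨ cancel e L (𝗐 μ) (𝗐 μ') (+ N) ⟩
        (L + e) + (L + e)                        ∎
        where
        cancel : ∀ e L W W' N → e + e - N + (W' - W) + (L + L + (W - W' + N)) ≡ (L + e) + (L + e)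
        cancel = solve-∀

    at-1-M : ∀ v i j → LFiniteAt (1ℚ ℚ.- half M) (ℚ.- Δα v i j) (ℚ.- Δβ v i j) ⇔ 0ℤ < upper v i j + (+ 1 - e)
    at-1-M v i j = LFiniteAt⇔0< (ℚ.- Δα v i j) (ℚ.- Δβ v i j) (+ 2 - M) (- (𝗐 μ' - 𝗐 μ)) (- - 2u+c v i j) (U + (+ 1 - e))
                     (sym (half-- (+ 2) M))
                     (neg-+ (Δα v i j) (Δβ v i j) (𝗐 μ' - 𝗐 μ) (Δα+Δβ v i j))
                     (neg-- (Δα v i j) (Δβ v i j) (- 2u+c v i j) (Δα-Δβ v i j))
                     argument≡
      where
      U = upper v i j
      argument≡ : + 2 - M + - (𝗐 μ' - 𝗐 μ) + + ℤ.∣ - - 2u+c v i j ∣ ≡ (U + (+ 1 - e)) + (U + (+ 1 - e))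
      argument≡ = begin
        + 2 - M + - (𝗐 μ' - 𝗐 μ) + + ℤ.∣ - - 2u+c v i j ∣
          ≡⟨ cong (λ t → + 2 - M + - (𝗐 μ' - 𝗐 μ) + + t)
                  (trans (ℤP.∣-i∣≡∣i∣ (- 2u+c v i j)) (ℤP.∣-i∣≡∣i∣ (2u+c v i j))) ⟩
        + 2 - M + - (𝗐 μ' - 𝗐 μ) + spread v i j  ≡⟨ cong (λ t → + 2 - M + - (𝗐 μ' - 𝗐 μ) + t) (spread≡upper v i j) ⟩
        + 2 - M + - (𝗐 μ' - 𝗐 μ) + (U + U - c)   ≡⟨ cancel e U (𝗐 μ) (𝗐 μ') (+ N) ⟩
        (U + (+ 1 - e)) + (U + (+ 1 - e))         ∎
        where
        cancel : ∀ e U W W' N → + 2 - (e + e - N) + - (W' - W) + (U + U - (W - W' + N))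
                               ≡ (U + (+ 1 - e)) + (U + (+ 1 - e))
        cancel = solve-∀

  mN : ℚ
  mN = ℚ.- (⟦ + N ⟧ ℚ.* ½)

  critical-pair⇔ : (Critical μ μ' mN × Critical μ μ' (1ℚ ℚ.+ mN)) ⇔ GapsSameSign
  critical-pair⇔ = mk⇔
    (λ (crit₀ , crit₁) v i j → Equivalence.from (sameSign⇔0<⊔ _ _) (Equivalence.to shifts⇔
       (Equivalence.to (critical⇔ 0ℤ) (subst (Critical μ μ') mN≡ crit₀) v i j ,
        Equivalence.to (critical⇔ (+ 1)) (subst (Critical μ μ') 1+mN≡ crit₁) v i j)))
    (λ same → subst (Critical μ μ') (sym mN≡) (Equivalence.from (critical⇔ 0ℤ) (λ v i j → proj₁ (positive same v i j))) ,
              subst (Critical μ μ') (sym 1+mN≡) (Equivalence.from (critical⇔ (+ 1)) (λ v i j → proj₂ (positive same v i j))))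
    where
    mN≡ : mN ≡ half (0ℤ + 0ℤ - + N)
    mN≡ = trans (sym (half-neg (+ N))) (cong half (sym (ℤP.+-identityˡ (- + N))))
    1+mN≡ : 1ℚ ℚ.+ mN ≡ half (+ 1 + + 1 - + N)
    1+mN≡ = sym (half-- (+ 2) (+ N))
    shifts⇔ : ∀ {L U} → ((0ℤ < L + 0ℤ × 0ℤ < U + + 1) × (0ℤ < L + + 1 × 0ℤ < U + 0ℤ)) ⇔ (0ℤ < L × 0ℤ < U)
    shifts⇔ {L} {U} = mk⇔
      (λ ((0<L , _) , (_ , 0<U)) → subst (0ℤ <_) (ℤP.+-identityʳ L) 0<L , subst (0ℤ <_) (ℤP.+-identityʳ U) 0<U)
      (λ (0<L , 0<U) → (subst (0ℤ <_) (sym (ℤP.+-identityʳ L)) 0<L , 0<+1 0<U) ,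
                       (0<+1 0<L , subst (0ℤ <_) (sym (ℤP.+-identityʳ U)) 0<U))
      where
      0<+1 : ∀ {x} → 0ℤ < x → 0ℤ < x + + 1
      0<+1 0<x = ℤP.+-mono-<-≤ 0<x (ℤ.+≤+ ℕ.z≤n)
    positive : GapsSameSign → ∀ v i j →
      (0ℤ < lower v i j + 0ℤ × 0ℤ < upper v i j + + 1) × (0ℤ < lower v i j + + 1 × 0ℤ < upper v i j + 0ℤ)
    positive same v i j = Equivalence.from shifts⇔ (Equivalence.to (sameSign⇔0<⊔ _ _) (same v i j))

  width-term : ∀ v i j → ℚ.∣ α μ v i ℚ.- α μ' v j ℚ.- β μ v i ℚ.+ β μ' v j ∣ ≡ ⟦ spread v i j ⟧
  width-term v i j = begin
    ℚ.∣ α μ v i ℚ.- α μ' v j ℚ.- β μ v i ℚ.+ β μ' v j ∣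
      ≡⟨ cong ℚ.∣_∣ (regroup (α μ v i) (α μ' v j) (β μ v i) (β μ' v j)) ⟩
    ℚ.∣ Δα v i j ℚ.- Δβ v i j ∣                        ≡⟨ cong ℚ.∣_∣ (Δα-Δβ v i j) ⟩
    ℚ.∣ ⟦ - 2u+c v i j ⟧ ∣                              ≡⟨ ⟦⟧-∣∣ (- 2u+c v i j) ⟨
    ⟦ + ℤ.∣ - 2u+c v i j ∣ ⟧                            ≡⟨ cong (λ t → ⟦ + t ⟧) (ℤP.∣-i∣≡∣i∣ (2u+c v i j)) ⟩
    ⟦ spread v i j ⟧                                    ∎
    where
    open ≡-Reasoning
    regroup : ∀ x x' y y' → x ℚ.- x' ℚ.- y ℚ.+ y' ≡ (x ℚ.- x') ℚ.- (y ℚ.- y')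
    regroup = RingSolver.solve-∀ ℚ-ring

  module _ (nonempty : triples r n n' ≢ []) where

    ⟦⟧≤width⇔ : ∀ K → ⟦ K ⟧ ℚ.≤ cuspidalWidth μ μ' ⇔ (∀ v i j → K ≤ spread v i j)
    ⟦⟧≤width⇔ K = mk⇔
      (λ K≤ℓ v i j → ⟦⟧-cancel-≤ (subst (⟦ K ⟧ ℚ.≤_) (width-term v i j)
        (Equivalence.to All-triples⇔ (AllP.map⁻ (Equivalence.to (≤minList⇔ _ (map-nonempty nonempty)) K≤ℓ)) v i j)))
      (λ K≤spread → Equivalence.from (≤minList⇔ _ (map-nonempty nonempty)) (AllP.map⁺ (Equivalence.from All-triples⇔
        λ v i j → subst (⟦ K ⟧ ℚ.≤_) (sym (width-term v i j)) (⟦⟧-mono-≤ (K≤spread v i j)))))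
      where
      map-nonempty : ∀ {A B : Set} {f : A → B} {xs : List A} → xs ≢ [] → map f xs ≢ []
      map-nonempty {xs = []}    xs≢[] = contradiction refl xs≢[]
      map-nonempty {xs = _ ∷ _} _     = λ ()

    width-bounds⇔ :
      (mN ℚ.+ 1ℚ ℚ.- cuspidalWidth μ μ' ℚ.* ½ ℚ.≤ abelianWidth μ μ'
       × abelianWidth μ μ' ℚ.≤ mN ℚ.- 1ℚ ℚ.+ cuspidalWidth μ μ' ℚ.* ½)
      ⇔ GapsSameSign
    width-bounds⇔ = mk⇔
      (λ (lo , hi) v i j → Equivalence.from (sameSign⇔0<⊔ _ _)
         (Equivalence.to upper-bound⇔ hi v i j , Equivalence.to lower-bound⇔ lo v i j))
      (λ same → Equivalence.from lower-bound⇔ (λ v i j → proj₂ (positive same v i j)) ,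
                Equivalence.from upper-bound⇔ (λ v i j → proj₁ (positive same v i j)))
      where
      ℓ a : ℚ
      ℓ = cuspidalWidth μ μ'
      a = abelianWidth μ μ'
      a≡ : a ≡ half (𝗐 μ - 𝗐 μ')
      a≡ = cong (ℚ._* ½) (sym (⟦⟧-- (𝗐 μ) (𝗐 μ')))
      mN≡ : mN ≡ half (- + N)
      mN≡ = sym (half-neg (+ N))
      positive : GapsSameSign → ∀ v i j → 0ℤ < lower v i j × 0ℤ < upper v i j
      positive same v i j = Equivalence.to (sameSign⇔0<⊔ _ _) (same v i j)
      open SetoidReasoning (⇔.⇔-setoid 0ℓ)

      bound⇔ : ∀ k (x : Fin r → Fin n → Fin n' → ℤ) → (∀ v i j → spread v i j ≡ x v i j + x v i j + k) →
        half (k + + 2) ℚ.≤ ℓ ℚ.* ½ ⇔ (∀ v i j → 0ℤ < x v i j)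
      bound⇔ k x spread≡ = begin
        half (k + + 2) ℚ.≤ ℓ ℚ.* ½              ≈⟨ half≤*½⇔ (k + + 2) ℓ ⟩
        ⟦ k + + 2 ⟧ ℚ.≤ ℓ                      ≈⟨ ⟦⟧≤width⇔ (k + + 2) ⟩
        (∀ v i j → k + + 2 ≤ spread v i j)     ≈⟨ mk⇔ (λ le v i j → Equivalence.to (bound-at v i j) (le v i j))
                                                        (λ pos v i j → Equivalence.from (bound-at v i j) (pos v i j)) ⟩
        (∀ v i j → 0ℤ < x v i j)               ∎
        where
        bound-at : ∀ v i j → k + + 2 ≤ spread v i j ⇔ 0ℤ < x v i j
        bound-at v i j = subst (λ t → (k + + 2 ≤ t) ⇔ (0ℤ < x v i j)) (sym (spread≡ v i j)) (k+2≤x+x+k⇔0<x k (x v i j))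

      lower-bound⇔ : mN ℚ.+ 1ℚ ℚ.- ℓ ℚ.* ½ ℚ.≤ a ⇔ (∀ v i j → 0ℤ < upper v i j)
      lower-bound⇔ = begin
        mN ℚ.+ 1ℚ ℚ.- ℓ ℚ.* ½ ℚ.≤ a   ≈⟨ p-r≤q⇔p-q≤r (mN ℚ.+ 1ℚ) a (ℓ ℚ.* ½) ⟩
        mN ℚ.+ 1ℚ ℚ.- a ℚ.≤ ℓ ℚ.* ½   ≡⟨ cong (ℚ._≤ ℓ ℚ.* ½) difference≡ ⟩
        half (- c + + 2) ℚ.≤ ℓ ℚ.* ½   ≈⟨ bound⇔ (- c) upper spread≡upper ⟩
        (∀ v i j → 0ℤ < upper v i j)   ∎
        where
        difference≡ : mN ℚ.+ 1ℚ ℚ.- a ≡ half (- c + + 2)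
        difference≡ = trans (cong₂ (λ x y → x ℚ.+ 1ℚ ℚ.- y) mN≡ a≡)
          (trans (cong (ℚ._- half (𝗐 μ - 𝗐 μ')) (sym (half-+ (- + N) (+ 2))))
          (trans (sym (half-- (- + N + + 2) (𝗐 μ - 𝗐 μ'))) (cong half (regroup (𝗐 μ) (𝗐 μ') (+ N)))))
          where
          regroup : ∀ W W' N → - N + + 2 - (W - W') ≡ - (W - W' + N) + + 2
          regroup = solve-∀

      upper-bound⇔ : a ℚ.≤ mN ℚ.- 1ℚ ℚ.+ ℓ ℚ.* ½ ⇔ (∀ v i j → 0ℤ < lower v i j)
      upper-bound⇔ = begin
        a ℚ.≤ mN ℚ.- 1ℚ ℚ.+ ℓ ℚ.* ½   ≈⟨ p≤q+r⇔p-q≤r a (mN ℚ.- 1ℚ) (ℓ ℚ.* ½) ⟩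
        a ℚ.- (mN ℚ.- 1ℚ) ℚ.≤ ℓ ℚ.* ½ ≡⟨ cong (ℚ._≤ ℓ ℚ.* ½) difference≡ ⟩
        half (c + + 2) ℚ.≤ ℓ ℚ.* ½     ≈⟨ bound⇔ c lower spread≡lower ⟩
        (∀ v i j → 0ℤ < lower v i j)   ∎
        where
        difference≡ : a ℚ.- (mN ℚ.- 1ℚ) ≡ half (c + + 2)
        difference≡ = trans (cong₂ (λ x y → x ℚ.- (y ℚ.- 1ℚ)) a≡ mN≡)
          (trans (cong (λ x → half (𝗐 μ - 𝗐 μ') ℚ.- x) (sym (half-- (- + N) (+ 2))))
          (trans (sym (half-- (𝗐 μ - 𝗐 μ') (- + N - + 2))) (cong half (regroup (𝗐 μ) (𝗐 μ') (+ N)))))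
          where
          regroup : ∀ W W' N → W - W' - (- N - + 2) ≡ W - W' + N + + 2
          regroup = solve-∀

  joined : Emb r → Fin N → ℤ
  joined η = shifted μ η ++ rightBlock η

  -- An inversion of joined η pairs a left entry i with a larger right entry j: a positive gap η i j.
  len≡positiveGaps : ∀ η (w : Permutation′ N) → StrictlyDecreasing (joined η ∘ (w ⟨$⟩ʳ_)) →
    len w ≡ ∑[ i < n ] ∑[ j < n' ] indicator (0ℤ <? gap η i j)
  len≡positiveGaps η w desc = begin
    len w                                                        ≡⟨ len≡inversions (joined η) w desc ⟩
    inversions (joined η)
      ≡⟨ inversions-++ _ _ (shifted-strictlyDecreasing μ η) (rightBlock-strictlyDecreasing η) ⟩
    ∑[ i < n ] ∑[ j < n' ] indicator (shifted μ η i <? rightBlock η j)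
      ≡⟨ sum-cong-≗ {n} (λ i → sum-cong-≗ {n'} λ j → let <⇔ = <⇔0<- (shifted μ η i) (rightBlock η j) in
           indicator-cong _ _ (Equivalence.to <⇔) (Equivalence.from <⇔)) ⟩
    ∑[ i < n ] ∑[ j < n' ] indicator (0ℤ <? gap η i j)          ∎
    where open ≡-Reasoning

  positiveGaps-pair : ∀ v → ∑[ i < n ] ∑[ j < n' ] indicator (0ℤ <? gap (v , true) i j)
                          ℕ.+ ∑[ i < n ] ∑[ j < n' ] indicator (0ℤ <? gap (v , false) i j)
                          ≡ ∑[ i < n ] ∑[ j < n' ] signCount c (gap (v , false) i j)
  positiveGaps-pair v = begin
    ∑[ i < n ] ∑[ j < n' ] indicator (0ℤ <? gap (v , true) i j) ℕ.+ ∑[ i < n ] ∑[ j < n' ] positive (v , false) i j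
      ≡⟨ cong (ℕ._+ ∑[ i < n ] ∑[ j < n' ] positive (v , false) i j) reflected ⟩
    ∑[ i < n ] ∑[ j < n' ] indicator (u i j + c <? 0ℤ) ℕ.+ ∑[ i < n ] ∑[ j < n' ] positive (v , false) i j
      ≡⟨ ∑-distrib-+ (λ i → ∑[ j < n' ] indicator (u i j + c <? 0ℤ)) (λ i → ∑[ j < n' ] positive (v , false) i j) ⟨
    ∑[ i < n ] (∑[ j < n' ] indicator (u i j + c <? 0ℤ) ℕ.+ ∑[ j < n' ] positive (v , false) i j)
      ≡⟨ sum-cong-≗ (λ i → ∑-distrib-+ (λ j → indicator (u i j + c <? 0ℤ)) (positive (v , false) i)) ⟨
    ∑[ i < n ] ∑[ j < n' ] signCount c (u i j) ∎
    where
    open ≡-Reasoning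
    u = gap (v , false)
    positive : Emb r → Fin n → Fin n' → ℕ
    positive η i j = indicator (0ℤ <? gap η i j)
    reflected : ∑[ i < n ] ∑[ j < n' ] positive (v , true) i j ≡ ∑[ i < n ] ∑[ j < n' ] indicator (u i j + c <? 0ℤ)
    reflected = begin
      ∑[ i < n ] ∑[ j < n' ] positive (v , true) i j
        ≡⟨ sum-permute (λ i → ∑[ j < n' ] positive (v , true) i j) Perm.reverse ⟩
      ∑[ i < n ] ∑[ j < n' ] positive (v , true) (opposite i) j
        ≡⟨ sum-cong-≗ (λ i → sum-permute (positive (v , true) (opposite i)) Perm.reverse) ⟩
      ∑[ i < n ] ∑[ j < n' ] positive (v , true) (opposite i) (opposite j)
        ≡⟨ sum-cong-≗ (λ i → sum-cong-≗ λ j → indicator-cong _ _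
             (λ 0<gap → 0<-i⇒i<0 (subst (0ℤ <_) (gap-opposite v i j) 0<gap))
             (λ u+c<0 → subst (0ℤ <_) (sym (gap-opposite v i j)) (ℤP.neg-mono-< u+c<0))) ⟩
      ∑[ i < n ] ∑[ j < n' ] indicator (u i j + c <? 0ℤ) ∎

  concatWeights≡ : ∀ η p → concatWeights μ μ' η p ≡ ⟦ joined η p + + toℕ p ⟧
  concatWeights≡ η p with split n n' p
  ... | left i  = begin
    concatWeights μ μ' η (i ↑ˡ n')  ≡⟨ concatWeights-↑ˡ ⟩
    ⟦ b μ η i ⟧                     ≡⟨ cong ⟦_⟧ (restore (b μ η i) (+ toℕ i)) ⟩
    ⟦ shifted μ η i + + toℕ i ⟧
      ≡⟨ cong₂ (λ x t → ⟦ x + + t ⟧) (sym (lookup-++ˡ (shifted μ η) (rightBlock η) i)) (sym (FinP.toℕ-↑ˡ i n')) ⟩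
    ⟦ joined η (i ↑ˡ n') + + toℕ (i ↑ˡ n') ⟧ ∎
    where
    open ≡-Reasoning
    concatWeights-↑ˡ : concatWeights μ μ' η (i ↑ˡ n') ≡ ⟦ b μ η i ⟧
    concatWeights-↑ˡ rewrite FinP.splitAt-↑ˡ n i n' = refl
    restore : ∀ x t → x ≡ x - t + t
    restore = solve-∀
  ... | right j = begin
    concatWeights μ μ' η (n ↑ʳ j)   ≡⟨ concatWeights-↑ʳ ⟩
    ⟦ b μ' η j ⟧                    ≡⟨ cong ⟦_⟧ (restore (b μ' η j) (+ toℕ j) (+ n)) ⟩
    ⟦ rightBlock η j + (+ n + + toℕ j) ⟧
      ≡⟨ cong₂ (λ x t → ⟦ x + + t ⟧) (sym (lookup-++ʳ (shifted μ η) (rightBlock η) j)) (sym (FinP.toℕ-↑ʳ n j)) ⟩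
    ⟦ joined η (n ↑ʳ j) + + toℕ (n ↑ʳ j) ⟧ ∎
    where
    open ≡-Reasoning
    concatWeights-↑ʳ : concatWeights μ μ' η (n ↑ʳ j) ≡ ⟦ b μ' η j ⟧
    concatWeights-↑ʳ rewrite FinP.splitAt-↑ʳ n n' j = refl
    restore : ∀ x t m → x ≡ (x - t - m) + (m + t)
    restore = solve-∀

  dotAct≡ : ∀ η (w : Permutation′ N) k →
    dotAct (inv w) (concatWeights μ μ' η) k ≡ ⟦ joined η (w ⟨$⟩ʳ k) + + toℕ k ⟧
  dotAct≡ η w k = begin
    concatWeights μ μ' η p ℚ.+ ρ N p ℚ.- ρ N k
      ≡⟨ cong (λ y → y ℚ.+ ρ N p ℚ.- ρ N k) (trans (concatWeights≡ η p) (⟦⟧-+ x (+ toℕ p))) ⟩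
    ⟦ x ⟧ ℚ.+ ⟦ + toℕ p ⟧ ℚ.+ ρ N p ℚ.- ρ N k       ≡⟨ cancel ⟦ x ⟧ ⟦ + toℕ p ⟧ ⟦ + toℕ k ⟧ ((⟦ + N ⟧ ℚ.- 1ℚ) ℚ.* ½) ⟩
    ⟦ x ⟧ ℚ.+ ⟦ + toℕ k ⟧                           ≡⟨ ⟦⟧-+ x (+ toℕ k) ⟨
    ⟦ x + + toℕ k ⟧                                 ∎
    where
    open ≡-Reasoning
    p = w ⟨$⟩ʳ k
    x = joined η p
    cancel : ∀ x t s h → x ℚ.+ t ℚ.+ (h ℚ.- t) ℚ.- (h ℚ.- s) ≡ x ℚ.+ s
    cancel = RingSolver.solve-∀ ℚ-ring

  nonIncreasing⇔ : ∀ η (w : Permutation′ N) →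
    NonIncreasing (dotAct (inv w) (concatWeights μ μ' η)) ⇔ StrictlyDecreasing (joined η ∘ (w ⟨$⟩ʳ_))
  nonIncreasing⇔ η w = ⇔.trans
    (mk⇔ (λ ni k k' k≤k' → ⟦⟧-cancel-≤ (subst₂ ℚ._≤_ (dotAct≡ η w k') (dotAct≡ η w k) (ni k k' k≤k')))
         (λ le k k' k≤k' → subst₂ ℚ._≤_ (sym (dotAct≡ η w k')) (sym (dotAct≡ η w k)) (⟦⟧-mono-≤ (le k k' k≤k'))))
    (⇔.sym (strictlyDecreasing⇔ (joined η ∘ (w ⟨$⟩ʳ_))))

  injective⇒gap≢0 : ∀ η → Injective _≡_ _≡_ (joined η) → ∀ i j → gap η i j ≢ 0ℤ
  injective⇒gap≢0 η injective i j gap≡0 = ++-injective⇒≢ injective i j (sym (ℤP.i-j≡0⇒i≡j _ _ gap≡0))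

  sameSign⇒gap≢0 : GapsSameSign → ∀ η i j → gap η i j ≢ 0ℤ
  sameSign⇒gap≢0 same (v , false) i j = proj₁ (sameSign⇒≢0 (same v i j))
  sameSign⇒gap≢0 same (v , true)  i j gap≡0 = proj₂ (sameSign⇒≢0 (same v (opposite i) (opposite j)))
    (trans (sym (ℤP.neg-involutive _)) (cong -_ (trans (sym (gap-opposite v (opposite i) (opposite j)))
      (trans (cong₂ (gap (v , true)) (FinP.opposite-involutive i) (FinP.opposite-involutive j)) gap≡0))))

  KostantSorted : Set
  KostantSorted = ∃ λ (w : Emb r → Permutation′ N) →
    (∀ η → InWP0 n n' (w η))
    × (∀ η → NonIncreasing (dotAct (inv (w η)) (concatWeights μ μ' η)))
    × (∀ η → len (w η) ℕ.+ len (w (conj η)) ≡ n ℕ.* n')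

  lengths≡signCounts : ∀ v (w : Emb r → Permutation′ N) → (∀ η → StrictlyDecreasing (joined η ∘ (w η ⟨$⟩ʳ_))) →
    len (w (v , true)) ℕ.+ len (w (v , false)) ≡ ∑[ i < n ] ∑[ j < n' ] signCount c (gap (v , false) i j)
  lengths≡signCounts v w desc = trans (cong₂ ℕ._+_ (len≡positiveGaps (v , true) (w (v , true)) (desc (v , true)))
                                                   (len≡positiveGaps (v , false) (w (v , false)) (desc (v , false))))
                                      (positiveGaps-pair v)

  kostant⇔ : KostantSorted ⇔ GapsSameSign
  kostant⇔ = mk⇔ to from
    where
    to : KostantSorted → GapsSameSign
    to (w , _ , nonIncreasing , lengths) v i j =
      signCount≡1⇒sameSign (gap (v , false) i j) (signCount≡1 i j)
        (injective⇒gap≢0 (v , false) (injective (v , false)) i j)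
        (λ u+c≡0 → injective⇒gap≢0 (v , true) (injective (v , true)) (opposite i) (opposite j)
                     (trans (gap-opposite v i j) (cong -_ u+c≡0)))
      where
      desc : ∀ η → StrictlyDecreasing (joined η ∘ (w η ⟨$⟩ʳ_))
      desc η = Equivalence.to (nonIncreasing⇔ η (w η)) (nonIncreasing η)
      injective : ∀ η → Injective _≡_ _≡_ (joined η)
      injective η = descending⇒injective (joined η) (w η) (desc η)
      total : ∑[ i < n ] ∑[ j < n' ] signCount c (gap (v , false) i j) ≡ ∑[ i < n ] ∑[ j < n' ] 1
      total = trans (sym (lengths≡signCounts v w desc)) (trans (lengths (v , true)) (sym (sum²-1 n n')))
      -- Every term is ≤ 1 or every term is ≥ 1, according to the sign of c.
      signCount≡1 : ∀ i j → signCount c (gap (v , false) i j) ≡ 1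
      signCount≡1 with 0ℤ ≤? c
      ... | yes 0≤c = sum²-≡⇒≗ (λ i j → signCount≤1 (gap (v , false) i j) 0≤c) total
      ... | no  0≰c = λ i j → sym (sum²-≡⇒≗ (λ i j → 1≤signCount (gap (v , false) i j) (ℤP.≰⇒> 0≰c)) (sym total) i j)
    from : GapsSameSign → KostantSorted
    from same = w
              , (λ η → descending⇒InWP0 _ _ (shifted-strictlyDecreasing μ η) (rightBlock-strictlyDecreasing η) (w η) (desc η))
              , (λ η → Equivalence.from (nonIncreasing⇔ η (w η)) (desc η))
              , lengths
      where
      injective : ∀ η → Injective _≡_ _≡_ (joined η)
      injective η = ++-injective _ _ (shifted-strictlyDecreasing μ η) (rightBlock-strictlyDecreasing η) λ i j fi≡gj →
        sameSign⇒gap≢0 same η i j (trans (cong (_- shifted μ η i) (sym fi≡gj)) (ℤP.+-inverseʳ (shifted μ η i)))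
      w : Emb r → Permutation′ N
      w η = sortingPermutation (joined η) (injective η)
      desc : ∀ η → StrictlyDecreasing (joined η ∘ (w η ⟨$⟩ʳ_))
      desc η = sortingPermutation-descending (joined η) (injective η)
      lengths-at : ∀ v → len (w (v , true)) ℕ.+ len (w (v , false)) ≡ n ℕ.* n'
      lengths-at v = trans (lengths≡signCounts v w desc)
        (trans (sum-cong-≗ {n} λ i → sum-cong-≗ {n'} λ j → sameSign⇒signCount≡1 _ (same v i j)) (sum²-1 n n'))
      lengths : ∀ η → len (w η) ℕ.+ len (w (conj η)) ≡ n ℕ.* n'
      lengths (v , true)  = lengths-at v
      lengths (v , false) = trans (ℕP.+-comm (len (w (v , false))) _) (lengths-at v)

lemma3p5 : (r n n' : ℕ) → 1 ℕ.≤ r → 1 ℕ.≤ n → 1 ℕ.≤ n' → (A : AutAction r)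
    → (μ : StronglyPureWeight r A n) (μ' : StronglyPureWeight r A n')
    → let N = n ℕ.+ n'
          mN/2 = ℚ.- (⟦ + N ⟧ ℚ.* ½)
          ℓ = cuspidalWidth μ μ'
          a = abelianWidth μ μ'
          C1 = Critical μ μ' mN/2 × Critical μ μ' (1ℚ ℚ.+ mN/2)
          C2 = (mN/2 ℚ.+ 1ℚ ℚ.- ℓ ℚ.* ½ ℚ.≤ a) × (a ℚ.≤ mN/2 ℚ.- 1ℚ ℚ.+ ℓ ℚ.* ½)
          C3 = ∃ λ (w : Emb r → Permutation′ N) →
                 (∀ η → InWP0 n n' (w η))
                 × (∀ η → NonIncreasing (dotAct (inv (w η)) (concatWeights μ μ' η)))
                 × (∀ η → len (w η) ℕ.+ len (w (conj η)) ≡ n ℕ.* n')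
      in (C1 ⇔ C2) × (C2 ⇔ C3)
lemma3p5 (suc r) (suc n) (suc n') (ℕ.s≤s ℕ.z≤n) (ℕ.s≤s ℕ.z≤n) (ℕ.s≤s ℕ.z≤n) A μ μ' =
  ⇔.trans critical-pair⇔ (⇔.sym (width-bounds⇔ λ ())) ,
  ⇔.trans (width-bounds⇔ λ ()) (⇔.sym kostant⇔)
  where open WeightPair μ μ'
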